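{- For all integers $n$ and $k$, $$S_{pq}(n,k)=(-1)^{n+k}s_{p^{ -1}q^{ -1}}(-k,-n),\qquad S_q(n,k)=(-1)^{n+k}s_{q^{ -1}}(-k,-n),\qquad S(n,k)=(-1)^{n+k}s(-k,-n).$$
   Context: Let $p,q$ be indeterminates and work over the field $K=\mathbb{Q}(p^{1/2},q^{1/2})$. For $i\in\mathbb{Z}$ the $p,q$-number is $[i]_{pq}=\sqrt{pq}\,(p^i-q^i)/(p-q)$ (a Laurent polynomial in $p^{1/2},q^{1/2}$). The $p,q$-lower factorials are $(x;p,q)_m=\prod_{i=0}^{m-1}(x-[i]_{pq})$ for $m\ge0$ and $(x;p,q)_m=1\big/\prod_{i=m}^{ -1}(x-[i]_{pq})$ for $m<0$, regarded as Laurent series in $x^{ -1}$ over $K$ with leading term $x^m$. For integers $n,k$: $s_{pq}(n,k)$ is the coefficient of $x^k$ in $(x;p,q)_n$, and $S_{pq}(n,k)$ is defined by the (unique) expansion $x^n=\sum_{k\le n}S_{pq}(n,k)(x;p,q)_k$ as Laurent series in $x^{ -1}$ (with $S_{pq}(n,k)=0$ for $k>n$). $s_{p^{ -1}q^{ -1}}(n,k)$ denotes the image of $s_{pq}(n,k)$ under the field automorphism $p^{1/2}\mapsto p^{ -1/2},\ q^{1/2}\mapsto q^{ -1/2}$. The $q$-versions $s_q,S_q$ are obtained by setting $p=1$ (so the roots are $[i]_q=\sqrt{q}(q^i-1)/(q-1)$), $s_{q^{ -1}}$ is obtained from $s_q$ by $q^{1/2}\mapsto q^{ -1/2}$, and the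 classical Stirling numbers $s(n,k),S(n,k)$ are obtained by setting $p=q=1$ (roots $[i]=i$, so $(x)_m=x(x-1)\cdots(x-m+1)$ for $m\ge0$ and $(x)_m=1/((x+1)(x+2)\cdots(x-m))$ for $m<0$). -}

module Defs where

open import Level using (0ℓ)
open import Data.Bool using (Bool; true; false; if_then_else_; _∧_)
open import Data.Nat as ℕ using (ℕ; zero; suc)
import Data.Nat.Properties as ℕP
open import Data.Integer as ℤ using (ℤ; +_; -[1+_])
import Data.Integer.Properties as ℤP
open import Data.Product using (_×_; _,_)
open import Data.List using (List; []; _∷_; _++_; map; concatMap; foldr)
open import Relation.Nullary using (does)
open import Relation.Binary.PropositionalEquality using (_≡_)
open import Algebra.Bundles.Raw using (RawRing)

module Stirling (R : RawRing 0ℓ 0ℓ) (r : ℤ → RawRing.Carrier R) where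
  open RawRing R

  sumTo : ℕ → (ℕ → Carrier) → Carrier
  sumTo zero    f = 0#
  sumTo (suc n) f = sumTo n f + f n

  pow : Carrier → ℕ → Carrier
  pow c zero    = 1#
  pow c (suc n) = pow c n * c

  -- A Laurent series in x⁻¹ with coefficients in R:
  -- Σ_{j ≥ 0} co j · x^(top - j).
  record Series : Set where
    constructor series
    field
      top : ℤ
      co  : ℕ → Carrier
  open Series public

  coeff : Series → ℤ → Carrier
  coeff f m with top f ℤ.- m
  ... | + j     = co f j
  ... | -[1+ _ ] = 0#

  _·_ : Series → Series → Series
  f · g = series (top f ℤ.+ top g)
                 (λ j → sumTo (suc j) (λ t → co f t * co g (j ℕ.∸ t)))

  oneS : Series
  oneS = series (+ 0) (λ { zero → 1# ; (suc _) → 0# })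

  xPow : ℤ → Series
  xPow n = series n (λ { zero → 1# ; (suc _) → 0# })

  xMinus : Carrier → Series
  xMinus c = series (+ 1) (λ { zero → 1# ; (suc zero) → - c ; (suc (suc _)) → 0# })

  -- 1/(x - c) = Σ_{j ≥ 0} c^j x^(-1-j), the inverse of (x - c) in the
  -- ring of Laurent series in x⁻¹
  invXMinus : Carrier → Series
  invXMinus c = series -[1+ 0 ] (λ j → pow c j)

  fallPos : ℕ → Series
  fallPos zero    = oneS
  fallPos (suc n) = fallPos n · xMinus (r (+ n))

  -- 1 / ∏_{i=-(n+1)}^{-1} (x - r i)  =  ∏_{i=-(n+1)}^{-1} 1/(x - r i)
  fallNeg : ℕ → Series
  fallNeg zero    = invXMinus (r -[1+ 0 ])
  fallNeg (suc n) = fallNeg n · invXMinus (r -[1+ suc n ])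

  fall : ℤ → Series
  fall (+ n)     = fallPos n
  fall -[1+ n ]  = fallNeg n

  s : ℤ → ℤ → Carrier
  s n k = coeff (fall n) k

  -- S(n,k) is defined by the unique expansion x^n = Σ_{k ≤ n} S(n,k) (x)_k.
  -- Comparing coefficients of x^m (only k with m ≤ k ≤ n contribute, since
  -- (x)_k has leading term x^k) gives  Σ_{k=m}^{n} S(n,k) s(k,m) = δ_{nm},
  -- and since s(m,m) = 1 this determines S(n, n-d) by recursion on d:
  --   S(n,n) = 1,  S(n, n-(d+1)) = - Σ_{e=0}^{d} S(n, n-e) · s(n-e, n-(d+1)).
  -- STab n d e = S(n, n-e) for e ≤ d.
  private
    extend : (ℕ → Carrier) → ℕ → Carrier → (ℕ → Carrier)
    extend f k v e = if e ℕ.≡ᵇ k then v else f e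

  STab : ℤ → ℕ → (ℕ → Carrier)
  STab n zero    = λ _ → 1#
  STab n (suc d) =
    extend (STab n d) (suc d)
      (- sumTo (suc d) (λ e → STab n d e * s (n ℤ.- + e) (n ℤ.- + suc d)))

  S : ℤ → ℤ → Carrier
  S n k with n ℤ.- k
  ... | + d      = STab n d d
  ... | -[1+ _ ] = 0#

  signℕ : ℕ → Carrier
  signℕ zero    = 1#
  signℕ (suc n) = - signℕ n

  sign : ℤ → Carrier
  sign m = signℕ ℤ.∣ m ∣

-- The field K = ℚ(p^{1/2}, q^{1/2}).  Write a = p^{1/2}, b = q^{1/2}.
-- K is the fraction field of the Laurent polynomial ring ℤ[a^{±1}, b^{±1}].

-- Laurent polynomial: list of terms (c , i , j) meaning c · a^i · b^j
Poly : Set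
Poly = List (ℤ × ℤ × ℤ)

coeffP : Poly → ℤ → ℤ → ℤ
coeffP []                  i j = + 0
coeffP ((c , u , v) ∷ ps) i j =
  (if does (u ℤP.≟ i) ∧ does (v ℤP.≟ j) then c else + 0) ℤ.+ coeffP ps i j

_≈P_ : Poly → Poly → Set
P ≈P Q = ∀ i j → coeffP P i j ≡ coeffP Q i j

_+P_ : Poly → Poly → Poly
P +P Q = P ++ Q

-P_ : Poly → Poly
-P P = map (λ { (c , u , v) → (ℤ.- c , u , v) }) P

_*P_ : Poly → Poly → Poly
P *P Q = concatMap (λ { (c , u , v) →
           map (λ { (d , u' , v') → (c ℤ.* d , u ℤ.+ u' , v ℤ.+ v') }) Q }) P

mono : ℤ → ℤ → ℤ → Poly
mono c i j = (c , i , j) ∷ []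

-- elements of K as fractions num/den of Laurent polynomials
-- (den is nonzero for every element that arises below: all denominators
--  are products of p - q or q - 1 and monic-unit terms)
record K : Set where
  constructor _/_
  field
    num : Poly
    den : Poly

_≈K_ : K → K → Set
(n₁ / d₁) ≈K (n₂ / d₂) = (n₁ *P d₂) ≈P (n₂ *P d₁)

oneP : Poly
oneP = mono (+ 1) (+ 0) (+ 0)

K-rawRing : RawRing 0ℓ 0ℓ
K-rawRing = record
  { Carrier = K
  ; _≈_     = _≈K_
  ; _+_     = λ { (n₁ / d₁) (n₂ / d₂) → ((n₁ *P d₂) +P (n₂ *P d₁)) / (d₁ *P d₂) }
  ; _*_     = λ { (n₁ / d₁) (n₂ / d₂) → (n₁ *P n₂) / (d₁ *P d₂) }
  ; -_      = λ { (n / d) → (-P n) / d }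
  ; 0#      = [] / oneP
  ; 1#      = oneP / oneP
  }

-- The field automorphism p^{1/2} ↦ p^{-1/2}, q^{1/2} ↦ q^{-1/2}
invertP : Poly → Poly
invertP = map (λ { (c , u , v) → (c , ℤ.- u , ℤ.- v) })

invK : K → K
invK (n / d) = invertP n / invertP d

-- [i]_{pq} = √(pq) (p^i - q^i)/(p - q),  with √(pq) = a b, p = a², q = b²
pqNum : ℤ → K
pqNum i = (mono (+ 1) (+ 1) (+ 1) *P
            (mono (+ 1) (+ 2 ℤ.* i) (+ 0) +P (-P mono (+ 1) (+ 0) (+ 2 ℤ.* i))))
          / (mono (+ 1) (+ 2) (+ 0) +P (-P mono (+ 1) (+ 0) (+ 2)))

-- [i]_q = √q (q^i - 1)/(q - 1)   (the case p = 1)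
qNum : ℤ → K
qNum i = (mono (+ 1) (+ 0) (+ 1) *P
           (mono (+ 1) (+ 0) (+ 2 ℤ.* i) +P (-P mono (+ 1) (+ 0) (+ 0))))
         / (mono (+ 1) (+ 0) (+ 2) +P (-P mono (+ 1) (+ 0) (+ 0)))

module PQ = Stirling K-rawRing pqNum
module Q  = Stirling K-rawRing qNum
module Cl = Stirling ℤ.+-*-rawRing (λ i → i)

s-pq S-pq s-pq⁻¹ : ℤ → ℤ → K
s-pq   = PQ.s
S-pq   = PQ.S
s-pq⁻¹ n k = invK (PQ.s n k)

s-q S-q s-q⁻¹ : ℤ → ℤ → K
s-q   = Q.s
S-q   = Q.S
s-q⁻¹ n k = invK (Q.s n k)

s-cl S-cl : ℤ → ℤ → ℤ
s-cl = Cl.s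
S-cl = Cl.S

_*K_ : K → K → K
_*K_ = RawRing._*_ K-rawRing

signK : ℤ → K
signK = PQ.sign

signℤ : ℤ → ℤ
signℤ = Cl.sign

-- Over any commutative ring take roots r with r 0 = 0, put r′ i = - r (- i) and
-- Ŝ n k = (-1)^(n+k) s_{r′}(-k,-n).  Multiplying by x - r n (or dividing by it, for
-- negative n) gives s(n+1,k+1) = s(n,k) - r n · s(n,k+1) for all integers n, and the same
-- recurrence for s_{r′} becomes Ŝ(n+1,k+1) = Ŝ(n,k) + r(k+1) · Ŝ(n,k+1).  Together they make
-- the entries Σ_e Ŝ(n,n-e) s(n-e,n-d) of the product Ŝ s independent of n, and at n = d they
-- equal δ_{d0} because r 0 = 0.  So Ŝ is the inverse of the unitriangular matrix s, i.e. S = Ŝ.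
--
-- The automorphism p^{1/2}, q^{1/2} ↦ p^{-1/2}, q^{-1/2} sends [i] to -[-i], so it turns s
-- into s_{r′}.  The ring argument needs a genuine ring in place of K: fractions of Laurent
-- polynomials whose denominators are not zero divisors, on which cross-multiplication is an
-- equivalence.  The denominators p - q and q - 1 qualify since multiplying by them relates
-- coefficients whose exponents of q^{1/2} differ by 2.

module Submission where

open import Level using (0ℓ)
open import Algebra.Bundles using (CommutativeRing)
open import Algebra.Bundles.Raw using (RawRing)
open import Algebra.Core using (Op₁; Op₂)
open import Algebra.Structures using (IsCommutativeRing)
open import Data.Bool using (true; false; if_then_else_; _∧_)
import Data.Bool.Properties as Boolₚ
open import Data.Empty using (⊥-elim)
open import Data.List using (List; []; _∷_; _++_; map; concatMap)
import Data.List.Properties as Listₚ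
open import Data.Nat as ℕ using (ℕ; zero; suc; z≤n; s≤s)
import Data.Nat.Properties as ℕₚ
open import Data.Integer as ℤ using (ℤ; +_; -[1+_]; 1ℤ)
import Data.Integer.Properties as ℤₚ
open import Data.Integer.Tactic.RingSolver using (solve-∀)
open import Data.Product using (Σ; _×_; _,_; proj₁; proj₂)
open import Data.Sum using (inj₁; inj₂)
open import Relation.Binary.Core using (Rel)
open import Relation.Binary.Bundles using (Setoid)
open import Relation.Binary.Structures using (IsEquivalence)
open import Relation.Nullary using (does; yes; no)
import Relation.Binary.PropositionalEquality as ≡
open ≡ using (_≡_)
open import Function.Base using (id)
open import Defs

-- Stated with `1ℤ + i` for `ℤ.suc i` (the two are definitionally equal) so that the ring solver applies.
private
  suc-minus-suc : ∀ m n → (1ℤ ℤ.+ m) ℤ.- (1ℤ ℤ.+ n) ≡ 1ℤ ℤ.+ (m ℤ.- (1ℤ ℤ.+ n))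
  suc-minus-suc = solve-∀

  minus≡suc-minus-suc : ∀ m n → m ℤ.- n ≡ 1ℤ ℤ.+ (m ℤ.- (1ℤ ℤ.+ n))
  minus≡suc-minus-suc = solve-∀

  suc-+-suc : ∀ m n → (1ℤ ℤ.+ m) ℤ.+ (1ℤ ℤ.+ n) ≡ 1ℤ ℤ.+ (1ℤ ℤ.+ (m ℤ.+ n))
  suc-+-suc = solve-∀

  +-suc : ∀ m n → m ℤ.+ (1ℤ ℤ.+ n) ≡ 1ℤ ℤ.+ (m ℤ.+ n)
  +-suc = solve-∀

  suc-neg-suc : ∀ n → 1ℤ ℤ.+ ℤ.- (1ℤ ℤ.+ n) ≡ ℤ.- n
  suc-neg-suc = solve-∀

  suc-minus-suc-cancel : ∀ m n → (1ℤ ℤ.+ m) ℤ.- (1ℤ ℤ.+ n) ≡ m ℤ.- n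
  suc-minus-suc-cancel = solve-∀

  suc-minus : ∀ m n → (1ℤ ℤ.+ m) ℤ.- n ≡ 1ℤ ℤ.+ (m ℤ.- n)
  suc-minus = solve-∀

  neg-suc-minus-neg : ∀ n → ℤ.- (1ℤ ℤ.+ n) ℤ.- ℤ.- n ≡ -[1+ 0 ]
  neg-suc-minus-neg = solve-∀

  neg-minus-neg : ∀ m n → ℤ.- m ℤ.- ℤ.- n ≡ n ℤ.- m
  neg-minus-neg = solve-∀

  minus-minus : ∀ m n → m ℤ.- (m ℤ.- n) ≡ n
  minus-minus = solve-∀

private
  minus-difference : ∀ m n d → m ℤ.- n ≡ + d → m ℤ.- + d ≡ n
  minus-difference m n d eq = ≡.trans (≡.cong (λ t → m ℤ.- t) (≡.sym eq)) (minus-minus m n)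

  [1+d]-e≡1+[d∸e] : ∀ {d e} → e ℕ.≤ d → + suc d ℤ.- + e ≡ + suc (d ℕ.∸ e)
  [1+d]-e≡1+[d∸e] {d} {e} e≤d = ≡.trans (ℤₚ.m-n≡m⊖n (suc d) e)
    (≡.trans (ℤₚ.⊖-≥ (ℕₚ.m≤n⇒m≤1+n e≤d)) (≡.cong +_ (ℕₚ.+-∸-assoc 1 e≤d)))

  ≡ᵇ-refl : ∀ n → (n ℕ.≡ᵇ n) ≡ true
  ≡ᵇ-refl zero    = ≡.refl
  ≡ᵇ-refl (suc n) = ≡ᵇ-refl n

  ≤⇒≡ᵇ-suc-false : ∀ {m n} → m ℕ.≤ n → (m ℕ.≡ᵇ suc n) ≡ false
  ≤⇒≡ᵇ-suc-false z≤n       = ≡.refl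
  ≤⇒≡ᵇ-suc-false (s≤s m≤n) = ≤⇒≡ᵇ-suc-false m≤n

-- Inversion of the Stirling matrices over a commutative ring

module StirlingDuality (R : CommutativeRing 0ℓ 0ℓ) where
  open CommutativeRing R
  open import Algebra.Properties.Ring ring using (-‿involutive; -‿distribˡ-*; -‿distribʳ-*; -0#≈0#)
  open import Algebra.Properties.AbelianGroup +-abelianGroup using (xyx⁻¹≈y; inverseʳ-unique)
  open import Algebra.Solver.Ring.NaturalCoefficients.Default commutativeSemiring using (solve; _:=_; _:+_; _:*_)
  open import Relation.Binary.Reasoning.Setoid setoid

  module Recurrence (r : ℤ → Carrier) where
    open Stirling rawRing r

    sumTo-cong : ∀ n {f g} → (∀ t → t ℕ.< n → f t ≈ g t) → sumTo n f ≈ sumTo n g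
    sumTo-cong zero    f≈g = refl
    sumTo-cong (suc n) f≈g = +-cong (sumTo-cong n (λ t t<n → f≈g t (ℕₚ.m<n⇒m<1+n t<n))) (f≈g n ℕₚ.≤-refl)

    sumTo-zero : ∀ n {f} → (∀ t → t ℕ.< n → f t ≈ 0#) → sumTo n f ≈ 0#
    sumTo-zero zero    f≈0 = refl
    sumTo-zero (suc n) f≈0 =
      trans (+-cong (sumTo-zero n (λ t t<n → f≈0 t (ℕₚ.m<n⇒m<1+n t<n))) (f≈0 n ℕₚ.≤-refl)) (+-identityʳ 0#)

    sumTo-*ʳ : ∀ n f c → sumTo n f * c ≈ sumTo n (λ t → f t * c)
    sumTo-*ʳ zero    f c = zeroˡ c
    sumTo-*ʳ (suc n) f c = trans (distribʳ c (sumTo n f) (f n)) (+-congʳ (sumTo-*ʳ n f c))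

    sumTo-suc : ∀ n f → sumTo (suc n) f ≈ f 0 + sumTo n (λ t → f (suc t))
    sumTo-suc zero    f = trans (+-identityˡ (f 0)) (sym (+-identityʳ (f 0)))
    sumTo-suc (suc n) f = trans (+-congʳ (sumTo-suc n f)) (+-assoc (f 0) _ _)

    ·-identityˡ : ∀ g j → co (oneS · g) j ≈ co g j
    ·-identityˡ g j = begin
      co (oneS · g) j                                        ≈⟨ sumTo-suc j _ ⟩
      1# * co g j + sumTo j (λ t → 0# * co g (j ℕ.∸ suc t))  ≈⟨ +-cong (*-identityˡ _) (sumTo-zero j (λ t _ → zeroˡ _)) ⟩
      co g j + 0#                                            ≈⟨ +-identityʳ _ ⟩
      co g j                                                 ∎

    -- coℤ f d is the coefficient of x ^ (top f - d); it is 0# for d < 0, above the leading term.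
    coℤ : Series → ℤ → Carrier
    coℤ f (+ d)    = co f d
    coℤ f -[1+ _ ] = 0#

    coeff≡coℤ : ∀ f m → coeff f m ≡ coℤ f (top f ℤ.- m)
    coeff≡coℤ f m with top f ℤ.- m
    ... | + _      = ≡.refl
    ... | -[1+ _ ] = ≡.refl

    top-fallPos : ∀ n → top (fallPos n) ≡ + n
    top-fallPos zero    = ≡.refl
    top-fallPos (suc n) = ≡.trans (≡.cong (ℤ._+ + 1) (top-fallPos n)) (≡.cong +_ (ℕₚ.+-comm n 1))

    top-fallNeg : ∀ n → top (fallNeg n) ≡ -[1+ n ]
    top-fallNeg zero    = ≡.refl
    top-fallNeg (suc n) = ≡.trans (≡.cong (ℤ._+ -[1+ 0 ]) (top-fallNeg n)) (≡.cong (λ m → -[1+ suc m ]) (ℕₚ.+-identityʳ n))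

    top-fall : ∀ n → top (fall n) ≡ n
    top-fall (+ n)    = top-fallPos n
    top-fall -[1+ n ] = top-fallNeg n

    s≡coℤ : ∀ n k → s n k ≡ coℤ (fall n) (n ℤ.- k)
    s≡coℤ n k = ≡.trans (coeff≡coℤ (fall n) k) (≡.cong (λ t → coℤ (fall n) (t ℤ.- k)) (top-fall n))

    coℤ-·xMinus : ∀ f c d → coℤ (f · xMinus c) (ℤ.suc d) ≈ coℤ f (ℤ.suc d) + (- c) * coℤ f d
    coℤ-·xMinus f c (+ j) = begin
      (sumTo j g + g j) + g (suc j)
        ≈⟨ +-cong (+-cong (sumTo-zero j (λ t t<j → trans (*-congˡ (reflexive (xMinus-vanishes j t<j))) (zeroʳ _)))
                          (*-congˡ (reflexive (≡.cong (co (xMinus c)) (ℕₚ.m+n∸n≡m 1 j)))))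
                  (*-congˡ (reflexive (≡.cong (co (xMinus c)) (ℕₚ.n∸n≡0 j)))) ⟩
      (0# + co f j * (- c)) + co f (suc j) * 1#  ≈⟨ +-cong (trans (+-identityˡ _) (*-comm _ _)) (*-identityʳ _) ⟩
      (- c) * co f j + co f (suc j)              ≈⟨ +-comm _ _ ⟩
      co f (suc j) + (- c) * co f j              ∎
      where
      g : ℕ → Carrier
      g t = co f t * co (xMinus c) (suc j ℕ.∸ t)
      xMinus-vanishes : ∀ {t} j → t ℕ.< j → co (xMinus c) (suc j ℕ.∸ t) ≡ 0#
      xMinus-vanishes {zero}  (suc j) _         = ≡.refl
      xMinus-vanishes {suc t} (suc j) (s≤s t<j) = xMinus-vanishes j t<j
    coℤ-·xMinus f c -[1+ zero ] = begin
      0# + co f 0 * 1#      ≈⟨ trans (+-identityˡ _) (*-identityʳ _) ⟩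
      co f 0                ≈⟨ +-identityʳ _ ⟨
      co f 0 + 0#           ≈⟨ +-congˡ (zeroʳ (- c)) ⟨
      co f 0 + (- c) * 0#   ∎
    coℤ-·xMinus f c -[1+ suc _ ] = sym (trans (+-identityˡ _) (zeroʳ _))

    -- Multiplying g = h / (x - c) back by x - c recovers h.
    coℤ-·invXMinus : ∀ g h c → (∀ j → co g j ≈ co (h · invXMinus c) j) →
                     ∀ d → coℤ h (ℤ.suc d) ≈ coℤ g (ℤ.suc d) + (- c) * coℤ g d
    coℤ-·invXMinus g h c g≈h/[x-c] (+ j) = begin
      co h (suc j)                                         ≈⟨ xyx⁻¹≈y (co g j * c) (co h (suc j)) ⟨
      (co g j * c + co h (suc j)) + - (co g j * c)         ≈⟨ +-cong (sym g-step) (trans (-‿cong (*-comm _ _)) (-‿distribˡ-* c _)) ⟩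
      co g (suc j) + (- c) * co g j                        ∎
      where
      g-step : co g (suc j) ≈ co g j * c + co h (suc j)
      g-step = begin
        co g (suc j)                                                           ≈⟨ g≈h/[x-c] (suc j) ⟩
        sumTo (suc j) (λ t → co h t * pow c (suc j ℕ.∸ t)) + co h (suc j) * pow c (suc j ℕ.∸ suc j)
          ≈⟨ +-cong (sumTo-cong (suc j) (λ t t<j+1 →
                       trans (*-congˡ (reflexive (≡.cong (pow c) (ℕₚ.+-∸-assoc 1 (ℕₚ.≤-pred t<j+1)))))
                             (sym (*-assoc _ _ _))))
                    (trans (*-congˡ (reflexive (≡.cong (pow c) (ℕₚ.n∸n≡0 j)))) (*-identityʳ _)) ⟩
        sumTo (suc j) (λ t → co h t * pow c (j ℕ.∸ t) * c) + co h (suc j)     ≈⟨ +-congʳ (sumTo-*ʳ (suc j) _ c) ⟨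
        sumTo (suc j) (λ t → co h t * pow c (j ℕ.∸ t)) * c + co h (suc j)     ≈⟨ +-congʳ (*-congʳ (g≈h/[x-c] j)) ⟨
        co g j * c + co h (suc j)                                              ∎
    coℤ-·invXMinus g h c g≈h/[x-c] -[1+ zero ] = begin
      co h 0               ≈⟨ trans (+-identityˡ _) (*-identityʳ _) ⟨
      0# + co h 0 * 1#     ≈⟨ g≈h/[x-c] 0 ⟨
      co g 0               ≈⟨ +-identityʳ _ ⟨
      co g 0 + 0#          ≈⟨ +-congˡ (zeroʳ (- c)) ⟨
      co g 0 + (- c) * 0#  ∎
    coℤ-·invXMinus g h c g≈h/[x-c] -[1+ suc _ ] = sym (trans (+-identityˡ _) (zeroʳ _))

    coℤ-fall-suc : ∀ n d → coℤ (fall (ℤ.suc n)) (ℤ.suc d) ≈ coℤ (fall n) (ℤ.suc d) + (- r n) * coℤ (fall n) d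
    coℤ-fall-suc (+ n)           = coℤ-·xMinus (fallPos n) (r (+ n))
    coℤ-fall-suc -[1+ zero ]     = coℤ-·invXMinus (fallNeg 0) oneS (r -[1+ 0 ]) (λ j → sym (·-identityˡ (invXMinus (r -[1+ 0 ])) j))
    coℤ-fall-suc -[1+ suc n ]    = coℤ-·invXMinus (fallNeg (suc n)) (fallNeg n) (r -[1+ suc n ]) (λ _ → refl)

    s-recurrence : ∀ n k → s (ℤ.suc n) (ℤ.suc k) ≈ s n k + (- r n) * s n (ℤ.suc k)
    s-recurrence n k = begin
      s (ℤ.suc n) (ℤ.suc k)                                   ≡⟨ ≡.trans (s≡coℤ (ℤ.suc n) (ℤ.suc k)) (≡.cong (coℤ (fall (ℤ.suc n))) (suc-minus-suc n k)) ⟩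
      coℤ (fall (ℤ.suc n)) (ℤ.suc (n ℤ.- ℤ.suc k))             ≈⟨ coℤ-fall-suc n (n ℤ.- ℤ.suc k) ⟩
      coℤ (fall n) (ℤ.suc (n ℤ.- ℤ.suc k)) + (- r n) * coℤ (fall n) (n ℤ.- ℤ.suc k)
        ≡⟨ ≡.cong₂ (λ a b → a + (- r n) * b)
                   (≡.sym (≡.trans (s≡coℤ n k) (≡.cong (coℤ (fall n)) (minus≡suc-minus-suc n k))))
                   (≡.sym (s≡coℤ n (ℤ.suc k))) ⟩
      s n k + (- r n) * s n (ℤ.suc k)                           ∎

    s-above-degree : ∀ n k j → n ℤ.- k ≡ -[1+ j ] → s n k ≡ 0#
    s-above-degree n k j n-k≡-[1+j] = ≡.trans (s≡coℤ n k) (≡.cong (coℤ (fall n)) n-k≡-[1+j])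

    co-fall-leading : ∀ n → co (fall n) 0 ≈ 1#
    co-fall-leading (+ zero)        = refl
    co-fall-leading (+ suc n)       = trans (+-identityˡ _) (trans (*-identityʳ _) (co-fall-leading (+ n)))
    co-fall-leading -[1+ zero ]     = refl
    co-fall-leading -[1+ suc n ]    = trans (+-identityˡ _) (trans (*-identityʳ _) (co-fall-leading -[1+ n ]))

    s-diagonal : ∀ n → s n n ≈ 1#
    s-diagonal n = trans (reflexive (≡.trans (s≡coℤ n n) (≡.cong (coℤ (fall n)) (ℤₚ.+-inverseʳ n)))) (co-fall-leading n)

    s-negative-power : ∀ m k → s (+ m) -[1+ k ] ≈ 0#
    s-negative-power zero    k = reflexive (s≡coℤ (+ 0) -[1+ k ])
    s-negative-power (suc m) k = begin
      s (ℤ.suc (+ m)) (ℤ.suc -[1+ suc k ])                        ≈⟨ s-recurrence (+ m) -[1+ suc k ] ⟩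
      s (+ m) -[1+ suc k ] + (- r (+ m)) * s (+ m) -[1+ k ]
        ≈⟨ +-cong (s-negative-power m (suc k)) (trans (*-congˡ (s-negative-power m k)) (zeroʳ _)) ⟩
      0# + 0#                                                     ≈⟨ +-identityʳ 0# ⟩
      0#                                                          ∎

    s-constant-term : r (+ 0) ≈ 0# → ∀ m → s (+ suc m) (+ 0) ≈ 0#
    s-constant-term r0≈0 m = begin
      s (ℤ.suc (+ m)) (ℤ.suc -[1+ 0 ])                  ≈⟨ s-recurrence (+ m) -[1+ 0 ] ⟩
      s (+ m) -[1+ 0 ] + (- r (+ m)) * s (+ m) (+ 0)    ≈⟨ +-cong (s-negative-power m 0) (last-vanishes m) ⟩
      0# + 0#                                           ≈⟨ +-identityʳ 0# ⟩
      0#                                                ∎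
      where
      last-vanishes : ∀ m → (- r (+ m)) * s (+ m) (+ 0) ≈ 0#
      last-vanishes zero    = trans (*-congʳ (trans (-‿cong r0≈0) -0#≈0#)) (zeroˡ _)
      last-vanishes (suc m) = trans (*-congˡ (s-constant-term r0≈0 m)) (zeroʳ _)

    sign-suc : ∀ m → sign (ℤ.suc m) ≈ - sign m
    sign-suc (+ _)          = refl
    sign-suc -[1+ zero ]    = sym (-‿involutive 1#)
    sign-suc -[1+ suc _ ]   = sym (-‿involutive _)

  module Duality (r r′ : ℤ → Carrier) (r′≈-r[-i] : ∀ i → r′ i ≈ - r (ℤ.- i)) (r0≈0 : r (+ 0) ≈ 0#) where
    open Stirling rawRing r using (sumTo; s; STab; S; sign)
    open Stirling rawRing r′ using () renaming (s to s′)
    open Recurrence r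
    open Recurrence r′ using () renaming
      (s-recurrence to s′-recurrence; s-above-degree to s′-above-degree; s-diagonal to s′-diagonal;
       s-negative-power to s′-negative-power)

    private
      x[yz]≈y[xz] : ∀ x y z → x * (y * z) ≈ y * (x * z)
      x[yz]≈y[xz] = solve 3 (λ x y z → x :* (y :* z) := y :* (x :* z)) refl

      -‿swap : ∀ x y z → x * ((- y) * z) ≈ - (y * (x * z))
      -‿swap x y z = begin
        x * ((- y) * z)    ≈⟨ *-congˡ (-‿distribˡ-* y z) ⟨
        x * - (y * z)      ≈⟨ -‿distribʳ-* x (y * z) ⟨
        - (x * (y * z))    ≈⟨ -‿cong (x[yz]≈y[xz] x y z) ⟩
        - (y * (x * z))    ∎

      distrib-cancel : ∀ a b c → a * (b + c) + - (a * c) ≈ a * b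
      distrib-cancel a b c = begin
        a * (b + c) + - (a * c)    ≈⟨ +-congʳ (trans (distribˡ a b c) (+-comm _ _)) ⟩
        a * c + a * b + - (a * c)  ≈⟨ xyx⁻¹≈y (a * c) (a * b) ⟩
        a * b                      ∎

    Ŝ : ℤ → ℤ → Carrier
    Ŝ n k = sign (n ℤ.+ k) * s′ (ℤ.- k) (ℤ.- n)

    Ŝ-recurrence : ∀ n k → Ŝ (ℤ.suc n) (ℤ.suc k) ≈ Ŝ n k + r (ℤ.suc k) * Ŝ n (ℤ.suc k)
    Ŝ-recurrence n k = begin
      sign (ℤ.suc n ℤ.+ ℤ.suc k) * x              ≈⟨ *-congʳ sign-n+k+2 ⟩
      σ * x                                      ≈⟨ distrib-cancel σ x (ρ * y) ⟨
      σ * (x + ρ * y) + - (σ * (ρ * y))          ≈⟨ +-cong (*-congˡ (sym s′-step)) (sym (-‿swap ρ σ y)) ⟩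
      σ * z + ρ * ((- σ) * y)                    ≈⟨ +-congˡ (*-congˡ (*-congʳ (sym sign-n+k+1))) ⟩
      σ * z + ρ * (sign (n ℤ.+ ℤ.suc k) * y)     ∎
      where
      σ ρ x y z : Carrier
      σ = sign (n ℤ.+ k)
      ρ = r (ℤ.suc k)
      x = s′ (ℤ.- ℤ.suc k) (ℤ.- ℤ.suc n)
      y = s′ (ℤ.- ℤ.suc k) (ℤ.- n)
      z = s′ (ℤ.- k) (ℤ.- n)
      sign-n+k+2 : sign (ℤ.suc n ℤ.+ ℤ.suc k) ≈ σ
      sign-n+k+2 = trans (reflexive (≡.cong sign (suc-+-suc n k)))
        (trans (sign-suc (ℤ.suc (n ℤ.+ k))) (trans (-‿cong (sign-suc (n ℤ.+ k))) (-‿involutive σ)))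
      sign-n+k+1 : sign (n ℤ.+ ℤ.suc k) ≈ - σ
      sign-n+k+1 = trans (reflexive (≡.cong sign (+-suc n k))) (sign-suc (n ℤ.+ k))
      -r′≈ρ : - r′ (ℤ.- ℤ.suc k) ≈ ρ
      -r′≈ρ = trans (-‿cong (r′≈-r[-i] _)) (trans (-‿involutive _) (reflexive (≡.cong r (ℤₚ.neg-involutive (ℤ.suc k)))))
      s′-step : z ≈ x + ρ * y
      s′-step = begin
        z                                                               ≡⟨ ≡.cong₂ s′ (≡.sym (suc-neg-suc k)) (≡.sym (suc-neg-suc n)) ⟩
        s′ (ℤ.suc (ℤ.- ℤ.suc k)) (ℤ.suc (ℤ.- ℤ.suc n))                   ≈⟨ s′-recurrence (ℤ.- ℤ.suc k) (ℤ.- ℤ.suc n) ⟩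
        x + (- r′ (ℤ.- ℤ.suc k)) * s′ (ℤ.- ℤ.suc k) (ℤ.suc (ℤ.- ℤ.suc n))
          ≈⟨ +-congˡ (*-cong -r′≈ρ (reflexive (≡.cong (s′ (ℤ.- ℤ.suc k)) (suc-neg-suc n)))) ⟩
        x + ρ * y                                                       ∎

    Ŝ-above-diagonal : ∀ n → Ŝ n (ℤ.suc n) ≈ 0#
    Ŝ-above-diagonal n =
      trans (*-congˡ (reflexive (s′-above-degree (ℤ.- ℤ.suc n) (ℤ.- n) 0 (neg-suc-minus-neg n)))) (zeroʳ _)

    -- Ŝs n d is the (n, n - d) entry of the matrix product Ŝ s.
    Ŝs : ℤ → ℕ → Carrier
    Ŝs n d = sumTo (suc d) (λ e → Ŝ n (n ℤ.- + e) * s (n ℤ.- + e) (n ℤ.- + d))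

    private
      telescope-step : ∀ t a w u b ρ → t + a * (w + (- ρ) * u) + (b + ρ * a) * u ≈ (t + a * w) + b * u
      telescope-step t a w u b ρ = begin
        t + a * (w + m) + (b + ρ * a) * u          ≈⟨ rearrange t a w m b ρ u ⟩
        (t + a * w + b * u) + (a * m + ρ * (a * u)) ≈⟨ +-congˡ (trans (+-congʳ (-‿swap a ρ u)) (-‿inverseˡ _)) ⟩
        (t + a * w + b * u) + 0#                   ≈⟨ +-identityʳ _ ⟩
        t + a * w + b * u                          ∎
        where
        m : Carrier
        m = (- ρ) * u
        rearrange : ∀ t a w m b ρ u → t + a * (w + m) + (b + ρ * a) * u ≈ (t + a * w + b * u) + (a * m + ρ * (a * u))
        rearrange = solve 7 (λ t a w m b ρ u →
          t :+ a :* (w :+ m) :+ (b :+ ρ :* a) :* u := (t :+ a :* w :+ b :* u) :+ (a :* m :+ ρ :* (a :* u))) refl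

    -- Combining both recurrences, the partial sums of Ŝs at n + 1 telescope to those at n.
    Ŝs-partial-shift : ∀ n m d →
      sumTo (suc d) (λ e → Ŝ (ℤ.suc n) (ℤ.suc n ℤ.- + e) * s (ℤ.suc n ℤ.- + e) (ℤ.suc m))
      ≈ sumTo d (λ e → Ŝ n (n ℤ.- + e) * s (n ℤ.- + e) m) + Ŝ n (n ℤ.- + d) * s (ℤ.suc n ℤ.- + d) (ℤ.suc m)
    Ŝs-partial-shift n m zero = +-congˡ (*-congʳ Ŝ-diagonal-shift)
      where
      Ŝ-diagonal-shift : Ŝ (ℤ.suc n) (ℤ.suc n ℤ.- + 0) ≈ Ŝ n (n ℤ.- + 0)
      Ŝ-diagonal-shift = begin
        Ŝ (ℤ.suc n) (ℤ.suc n ℤ.- + 0)               ≡⟨ ≡.cong (Ŝ (ℤ.suc n)) (ℤₚ.+-identityʳ (ℤ.suc n)) ⟩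
        Ŝ (ℤ.suc n) (ℤ.suc n)                       ≈⟨ Ŝ-recurrence n n ⟩
        Ŝ n n + r (ℤ.suc n) * Ŝ n (ℤ.suc n)         ≈⟨ +-congˡ (trans (*-congˡ (Ŝ-above-diagonal n)) (zeroʳ _)) ⟩
        Ŝ n n + 0#                                  ≈⟨ +-identityʳ _ ⟩
        Ŝ n n                                       ≡⟨ ≡.cong (Ŝ n) (ℤₚ.+-identityʳ n) ⟨
        Ŝ n (n ℤ.- + 0)                             ∎
    Ŝs-partial-shift n m (suc d) = begin
      sumTo (suc d) f + Ŝ (ℤ.suc n) (ℤ.suc n ℤ.- + suc d) * s (ℤ.suc n ℤ.- + suc d) (ℤ.suc m)
        ≈⟨ +-cong (Ŝs-partial-shift n m d) (*-cong Ŝ-step (reflexive (≡.cong (λ i → s i (ℤ.suc m)) n+1-[d+1]≡n-d))) ⟩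
      (sumTo d g + a * s (ℤ.suc n ℤ.- + d) (ℤ.suc m)) + (b + ρ * a) * u
        ≈⟨ +-congʳ (+-congˡ (*-congˡ s-step)) ⟩
      (sumTo d g + a * (w + (- ρ) * u)) + (b + ρ * a) * u
        ≈⟨ telescope-step (sumTo d g) a w u b ρ ⟩
      (sumTo d g + a * w) + b * u
        ≡⟨ ≡.cong (λ i → (sumTo d g + a * w) + b * s i (ℤ.suc m)) n+1-[d+1]≡n-d ⟨
      (sumTo d g + a * w) + b * s (ℤ.suc n ℤ.- + suc d) (ℤ.suc m) ∎
      where
      f g : ℕ → Carrier
      f e = Ŝ (ℤ.suc n) (ℤ.suc n ℤ.- + e) * s (ℤ.suc n ℤ.- + e) (ℤ.suc m)
      g e = Ŝ n (n ℤ.- + e) * s (n ℤ.- + e) m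
      a b ρ u w : Carrier
      a = Ŝ n (n ℤ.- + d)
      b = Ŝ n (n ℤ.- + suc d)
      ρ = r (n ℤ.- + d)
      u = s (n ℤ.- + d) (ℤ.suc m)
      w = s (n ℤ.- + d) m
      n+1-[d+1]≡n-d : ℤ.suc n ℤ.- + suc d ≡ n ℤ.- + d
      n+1-[d+1]≡n-d = suc-minus-suc-cancel n (+ d)
      n-[d+1]+1≡n-d : ℤ.suc (n ℤ.- + suc d) ≡ n ℤ.- + d
      n-[d+1]+1≡n-d = ≡.trans (≡.sym (suc-minus-suc n (+ d))) n+1-[d+1]≡n-d
      Ŝ-step : Ŝ (ℤ.suc n) (ℤ.suc n ℤ.- + suc d) ≈ b + ρ * a
      Ŝ-step = begin
        Ŝ (ℤ.suc n) (ℤ.suc n ℤ.- + suc d)           ≡⟨ ≡.cong (Ŝ (ℤ.suc n)) (≡.trans n+1-[d+1]≡n-d (≡.sym n-[d+1]+1≡n-d)) ⟩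
        Ŝ (ℤ.suc n) (ℤ.suc (n ℤ.- + suc d))         ≈⟨ Ŝ-recurrence n (n ℤ.- + suc d) ⟩
        b + r (ℤ.suc (n ℤ.- + suc d)) * Ŝ n (ℤ.suc (n ℤ.- + suc d))
          ≡⟨ ≡.cong (λ i → b + r i * Ŝ n i) n-[d+1]+1≡n-d ⟩
        b + ρ * a                                    ∎
      s-step : s (ℤ.suc n ℤ.- + d) (ℤ.suc m) ≈ w + (- ρ) * u
      s-step = trans (reflexive (≡.cong (λ i → s i (ℤ.suc m)) (suc-minus n (+ d)))) (s-recurrence (n ℤ.- + d) m)

    Ŝs-shift : ∀ n d → Ŝs (ℤ.suc n) d ≈ Ŝs n d
    Ŝs-shift n d = begin
      Ŝs (ℤ.suc n) d
        ≈⟨ sumTo-cong (suc d) (λ e _ → *-congˡ (reflexive (≡.cong (s (ℤ.suc n ℤ.- + e)) (suc-minus n (+ d))))) ⟩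
      sumTo (suc d) (λ e → Ŝ (ℤ.suc n) (ℤ.suc n ℤ.- + e) * s (ℤ.suc n ℤ.- + e) (ℤ.suc (n ℤ.- + d)))
        ≈⟨ Ŝs-partial-shift n (n ℤ.- + d) d ⟩
      sumTo d g + Ŝ n (n ℤ.- + d) * s (ℤ.suc n ℤ.- + d) (ℤ.suc (n ℤ.- + d))
        ≈⟨ +-congˡ (*-congˡ diagonal) ⟩
      sumTo d g + Ŝ n (n ℤ.- + d) * s (n ℤ.- + d) (n ℤ.- + d) ∎
      where
      g : ℕ → Carrier
      g e = Ŝ n (n ℤ.- + e) * s (n ℤ.- + e) (n ℤ.- + d)
      diagonal : s (ℤ.suc n ℤ.- + d) (ℤ.suc (n ℤ.- + d)) ≈ s (n ℤ.- + d) (n ℤ.- + d)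
      diagonal = trans (reflexive (≡.cong (λ i → s i (ℤ.suc (n ℤ.- + d))) (suc-minus n (+ d))))
                       (trans (s-diagonal (ℤ.suc (n ℤ.- + d))) (sym (s-diagonal (n ℤ.- + d))))

    Ŝs-independent : ∀ n d → Ŝs n d ≈ Ŝs (+ 0) d
    Ŝs-independent (+ zero)       d = refl
    Ŝs-independent (+ suc a)      d = trans (Ŝs-shift (+ a) d) (Ŝs-independent (+ a) d)
    Ŝs-independent -[1+ zero ]    d = sym (Ŝs-shift -[1+ 0 ] d)
    Ŝs-independent -[1+ suc a ]   d = trans (sym (Ŝs-shift -[1+ suc a ] d)) (Ŝs-independent -[1+ a ] d)

    Ŝs-diagonal : ∀ n → Ŝs n 0 ≈ 1#
    Ŝs-diagonal n = begin
      Ŝs n 0                                 ≈⟨ Ŝs-independent n 0 ⟩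
      0# + (1# * s′ (+ 0) (+ 0)) * s (+ 0) (+ 0)  ≈⟨ trans (+-identityˡ _) (*-cong (*-identityˡ _) (s-diagonal (+ 0))) ⟩
      s′ (+ 0) (+ 0) * 1#                    ≈⟨ trans (*-identityʳ _) (s′-diagonal (+ 0)) ⟩
      1#                                     ∎

    -- At n = d + 1 every term vanishes: s (n - e) 0 for e ≤ d because r 0 ≈ 0, and Ŝ n 0 because s′ 0 (- n) is below x⁰.
    Ŝs-off-diagonal : ∀ n d → Ŝs n (suc d) ≈ 0#
    Ŝs-off-diagonal n d = begin
      Ŝs n (suc d)                                        ≈⟨ Ŝs-independent n (suc d) ⟩
      Ŝs (+ 0) (suc d)                                    ≈⟨ Ŝs-independent D (suc d) ⟨
      sumTo (suc d) f + Ŝ D (D ℤ.- D) * s (D ℤ.- D) (D ℤ.- D)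
        ≈⟨ +-cong (sumTo-zero (suc d) (λ e e<d+1 → trans (*-congˡ (early e<d+1)) (zeroʳ _))) (*-congʳ last) ⟩
      0# + 0# * s (D ℤ.- D) (D ℤ.- D)                     ≈⟨ trans (+-identityˡ _) (zeroˡ _) ⟩
      0#                                                  ∎
      where
      D : ℤ
      D = + suc d
      f : ℕ → Carrier
      f e = Ŝ D (D ℤ.- + e) * s (D ℤ.- + e) (D ℤ.- D)
      early : ∀ {e} → e ℕ.< suc d → s (D ℤ.- + e) (D ℤ.- D) ≈ 0#
      early {e} e<d+1 = trans (reflexive (≡.cong₂ s ([1+d]-e≡1+[d∸e] (ℕₚ.≤-pred e<d+1)) (ℤₚ.+-inverseʳ D)))
                            (s-constant-term r0≈0 (d ℕ.∸ e))
      last : Ŝ D (D ℤ.- D) ≈ 0#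
      last = trans (reflexive (≡.cong (Ŝ D) (ℤₚ.+-inverseʳ D))) (trans (*-congˡ (s′-negative-power 0 d)) (zeroʳ _))

    private
      earlier : ℤ → ℕ → Carrier
      earlier n d = sumTo (suc d) (λ e → STab n d e * s (n ℤ.- + e) (n ℤ.- + suc d))

      STab-suc : ∀ n d e → STab n (suc d) e ≡ (if e ℕ.≡ᵇ suc d then - earlier n d else STab n d e)
      STab-suc n d e = ≡.refl

    -- STab n (d + 1) adds the entry forced by Ŝs n (d + 1) ≈ 0#, which Ŝ satisfies.
    STab≈Ŝ : ∀ n d e → e ℕ.≤ d → STab n d e ≈ Ŝ n (n ℤ.- + e)
    STab≈Ŝ n zero zero z≤n = begin
      1#                                                ≈⟨ Ŝs-diagonal n ⟨
      0# + Ŝ n (n ℤ.- + 0) * s (n ℤ.- + 0) (n ℤ.- + 0)  ≈⟨ +-identityˡ _ ⟩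
      Ŝ n (n ℤ.- + 0) * s (n ℤ.- + 0) (n ℤ.- + 0)       ≈⟨ *-congˡ (s-diagonal (n ℤ.- + 0)) ⟩
      Ŝ n (n ℤ.- + 0) * 1#                              ≈⟨ *-identityʳ _ ⟩
      Ŝ n (n ℤ.- + 0)                                   ∎
    STab≈Ŝ n (suc d) e e≤d+1 with ℕₚ.m≤n⇒m<n∨m≡n e≤d+1
    ... | inj₁ e<d+1 = begin
      STab n (suc d) e  ≡⟨ ≡.trans (STab-suc n d e) (≡.cong (if_then - earlier n d else STab n d e) (≤⇒≡ᵇ-suc-false e≤d)) ⟩
      STab n d e        ≈⟨ STab≈Ŝ n d e e≤d ⟩
      Ŝ n (n ℤ.- + e)   ∎
      where
      e≤d : e ℕ.≤ d
      e≤d = ℕₚ.≤-pred e<d+1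
    ... | inj₂ ≡.refl = begin
      STab n (suc d) (suc d)  ≡⟨ ≡.trans (STab-suc n d (suc d)) (≡.cong (if_then - earlier n d else STab n d (suc d)) (≡ᵇ-refl d)) ⟩
      - earlier n d           ≈⟨ inverseʳ-unique (earlier n d) (Ŝ n (n ℤ.- + suc d)) earlier+Ŝ≈0 ⟨
      Ŝ n (n ℤ.- + suc d)     ∎
      where
      earlier+Ŝ≈0 : earlier n d + Ŝ n (n ℤ.- + suc d) ≈ 0#
      earlier+Ŝ≈0 = begin
        earlier n d + Ŝ n (n ℤ.- + suc d)
          ≈⟨ +-cong (sumTo-cong (suc d) (λ t t≤d → *-congʳ (STab≈Ŝ n d t (ℕₚ.≤-pred t≤d))))
                    (trans (sym (*-identityʳ _)) (*-congˡ (sym (s-diagonal (n ℤ.- + suc d))))) ⟩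
        Ŝs n (suc d)  ≈⟨ Ŝs-off-diagonal n d ⟩
        0#            ∎

    S≈Ŝ : ∀ n k → S n k ≈ Ŝ n k
    S≈Ŝ n k with n ℤ.- k in n-k≡
    ... | + d      = trans (STab≈Ŝ n d d ℕₚ.≤-refl) (reflexive (≡.cong (Ŝ n) (minus-difference n k d n-k≡)))
    ... | -[1+ j ] = sym (trans (*-congˡ (reflexive (s′-above-degree (ℤ.- k) (ℤ.- n) j (≡.trans (neg-minus-neg k n) n-k≡))))
                                (zeroʳ _))

module _ {A : Set} {_≈_ : Rel A 0ℓ} {_+_ _*_ : Op₂ A} { -_ : Op₁ A} {0# 1# : A} where
  open import Algebra.Definitions _≈_

  isCommutativeRing-fromLeftLaws :
    IsEquivalence _≈_ → Congruent₂ _+_ → Congruent₂ _*_ → Congruent₁ -_ →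
    Associative _+_ → Commutative _+_ → LeftIdentity 0# _+_ → LeftInverse 0# -_ _+_ →
    Associative _*_ → Commutative _*_ → LeftIdentity 1# _*_ → _*_ DistributesOverʳ _+_ →
    IsCommutativeRing _≈_ _+_ _*_ -_ 0# 1#
  isCommutativeRing-fromLeftLaws ≈-equiv +-cong *-cong -‿cong +-assoc +-comm +-idˡ -‿invˡ *-assoc *-comm *-idˡ distribʳ =
    record
      { isRing = record
        { +-isAbelianGroup = record
          { isGroup = record
            { isMonoid = record
              { isSemigroup = record { isMagma = record { isEquivalence = ≈-equiv ; ∙-cong = +-cong } ; assoc = +-assoc }
              ; identity    = comm∧idˡ⇒id +-comm +-idˡ }
            ; inverse = comm∧invˡ⇒inv +-comm -‿invˡ
            ; ⁻¹-cong = -‿cong }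
          ; comm = +-comm }
        ; *-cong     = *-cong
        ; *-assoc    = *-assoc
        ; *-identity = comm∧idˡ⇒id *-comm *-idˡ
        ; distrib    = comm∧distrʳ⇒distr +-cong *-comm distribʳ }
      ; *-comm = *-comm }
    where
    setoid : Setoid 0ℓ 0ℓ
    setoid = record { isEquivalence = ≈-equiv }
    open import Algebra.Consequences.Setoid setoid

-- Laurent polynomials in a = p^{1/2}, b = q^{1/2}

Term : Set
Term = ℤ × ℤ × ℤ

termCoeff : Term → ℤ → ℤ → ℤ
termCoeff (c , u , v) i j = if does (u ℤₚ.≟ i) ∧ does (v ℤₚ.≟ j) then c else + 0

mulTerm : Term → Term → Term
mulTerm (c , u , v) (d , u′ , v′) = (c ℤ.* d , u ℤ.+ u′ , v ℤ.+ v′)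

negTerm : Term → Term
negTerm (c , u , v) = (ℤ.- c , u , v)

sumOver : {A : Set} → List A → (A → ℤ) → ℤ
sumOver []       f = + 0
sumOver (x ∷ xs) f = f x ℤ.+ sumOver xs f

module _ {A : Set} where
  sumOver-cong : ∀ (xs : List A) {f g} → (∀ x → f x ≡ g x) → sumOver xs f ≡ sumOver xs g
  sumOver-cong []       f≡g = ≡.refl
  sumOver-cong (x ∷ xs) f≡g = ≡.cong₂ ℤ._+_ (f≡g x) (sumOver-cong xs f≡g)

  sumOver-++ : ∀ (xs ys : List A) f → sumOver (xs ++ ys) f ≡ sumOver xs f ℤ.+ sumOver ys f
  sumOver-++ []       ys f = ≡.sym (ℤₚ.+-identityˡ _)
  sumOver-++ (x ∷ xs) ys f = ≡.trans (≡.cong (λ z → f x ℤ.+ z) (sumOver-++ xs ys f)) (≡.sym (ℤₚ.+-assoc (f x) _ _))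

  sumOver-+ : ∀ (xs : List A) f g → sumOver xs (λ x → f x ℤ.+ g x) ≡ sumOver xs f ℤ.+ sumOver xs g
  sumOver-+ []       f g = ≡.refl
  sumOver-+ (x ∷ xs) f g = ≡.trans (≡.cong (λ z → f x ℤ.+ g x ℤ.+ z) (sumOver-+ xs f g)) (medial (f x) (g x) _ _)
    where
    medial : ∀ a b c d → a ℤ.+ b ℤ.+ (c ℤ.+ d) ≡ a ℤ.+ c ℤ.+ (b ℤ.+ d)
    medial = solve-∀

  sumOver-*ˡ : ∀ (xs : List A) c f → c ℤ.* sumOver xs f ≡ sumOver xs (λ x → c ℤ.* f x)
  sumOver-*ˡ []       c f = ℤₚ.*-zeroʳ c
  sumOver-*ˡ (x ∷ xs) c f = ≡.trans (ℤₚ.*-distribˡ-+ c (f x) _) (≡.cong (λ z → c ℤ.* f x ℤ.+ z) (sumOver-*ˡ xs c f))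

  sumOver-neg : ∀ (xs : List A) f → sumOver xs (λ x → ℤ.- f x) ≡ ℤ.- sumOver xs f
  sumOver-neg []       f = ≡.refl
  sumOver-neg (x ∷ xs) f = ≡.trans (≡.cong (λ z → ℤ.- f x ℤ.+ z) (sumOver-neg xs f)) (≡.sym (ℤₚ.neg-distrib-+ (f x) _))

  sumOver-map : ∀ {B : Set} (xs : List B) (g : B → A) f → sumOver (map g xs) f ≡ sumOver xs (λ x → f (g x))
  sumOver-map []       g f = ≡.refl
  sumOver-map (x ∷ xs) g f = ≡.cong (λ z → f (g x) ℤ.+ z) (sumOver-map xs g f)

  sumOver-concatMap : ∀ {B : Set} (xs : List B) (g : B → List A) f →
                      sumOver (concatMap g xs) f ≡ sumOver xs (λ x → sumOver (g x) f)
  sumOver-concatMap []       g f = ≡.refl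
  sumOver-concatMap (x ∷ xs) g f =
    ≡.trans (sumOver-++ (g x) (concatMap g xs) f) (≡.cong (λ z → sumOver (g x) f ℤ.+ z) (sumOver-concatMap xs g f))

sumOver-zero : ∀ {A : Set} (xs : List A) → sumOver xs (λ _ → + 0) ≡ + 0
sumOver-zero []       = ≡.refl
sumOver-zero (x ∷ xs) = ≡.trans (ℤₚ.+-identityˡ _) (sumOver-zero xs)

sumOver-comm : ∀ {A B : Set} (xs : List A) (ys : List B) (f : A → B → ℤ) →
               sumOver xs (λ x → sumOver ys (f x)) ≡ sumOver ys (λ y → sumOver xs (λ x → f x y))
sumOver-comm []       ys f = ≡.sym (sumOver-zero ys)
sumOver-comm (x ∷ xs) ys f =
  ≡.trans (≡.cong (λ z → sumOver ys (f x) ℤ.+ z) (sumOver-comm xs ys f)) (≡.sym (sumOver-+ ys (f x) _))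

coeffP-sumOver : ∀ P i j → coeffP P i j ≡ sumOver P (λ t → termCoeff t i j)
coeffP-sumOver []                i j = ≡.refl
coeffP-sumOver ((c , u , v) ∷ P) i j = ≡.cong (λ z → termCoeff (c , u , v) i j ℤ.+ z) (coeffP-sumOver P i j)

does-≡-cong : ∀ {a b c d : ℤ} → (a ≡ b → c ≡ d) → (c ≡ d → a ≡ b) → does (a ℤₚ.≟ b) ≡ does (c ℤₚ.≟ d)
does-≡-cong {a} {b} {c} {d} to from with a ℤₚ.≟ b | c ℤₚ.≟ d
... | yes _    | yes _    = ≡.refl
... | no _     | no _     = ≡.refl
... | yes a≡b  | no c≢d   = ⊥-elim (c≢d (to a≡b))
... | no a≢b   | yes c≡d  = ⊥-elim (a≢b (from c≡d))

does-≟-shift : ∀ u u′ i → does (u ℤ.+ u′ ℤₚ.≟ i) ≡ does (u′ ℤₚ.≟ i ℤ.- u)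
does-≟-shift u u′ i = does-≡-cong (λ eq → ≡.trans (cancel₁ u u′) (≡.cong (ℤ._- u) eq))
                                  (λ eq → ≡.trans (≡.cong (λ z → u ℤ.+ z) eq) (cancel₂ u i))
  where
  cancel₁ : ∀ u u′ → u′ ≡ (u ℤ.+ u′) ℤ.- u
  cancel₁ = solve-∀
  cancel₂ : ∀ u i → u ℤ.+ (i ℤ.- u) ≡ i
  cancel₂ = solve-∀

termCoeff-mulTerm : ∀ s t i j →
  termCoeff (mulTerm s t) i j ≡ proj₁ s ℤ.* termCoeff t (i ℤ.- proj₁ (proj₂ s)) (j ℤ.- proj₂ (proj₂ s))
termCoeff-mulTerm (c , u , v) (d , u′ , v′) i j rewrite does-≟-shift u u′ i | does-≟-shift v v′ j =
  scale (does (u′ ℤₚ.≟ i ℤ.- u) ∧ does (v′ ℤₚ.≟ j ℤ.- v))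
  where
  scale : ∀ b → (if b then c ℤ.* d else + 0) ≡ c ℤ.* (if b then d else + 0)
  scale true  = ≡.refl
  scale false = ≡.sym (ℤₚ.*-zeroʳ c)

termCoeff-negTerm : ∀ t i j → termCoeff (negTerm t) i j ≡ ℤ.- termCoeff t i j
termCoeff-negTerm (c , u , v) i j with does (u ℤₚ.≟ i) ∧ does (v ℤₚ.≟ j)
... | true  = ≡.refl
... | false = ≡.refl

coeffP-++ : ∀ P Q i j → coeffP (P ++ Q) i j ≡ coeffP P i j ℤ.+ coeffP Q i j
coeffP-++ P Q i j = ≡.trans (coeffP-sumOver (P ++ Q) i j)
  (≡.trans (sumOver-++ P Q _) (≡.sym (≡.cong₂ ℤ._+_ (coeffP-sumOver P i j) (coeffP-sumOver Q i j))))

coeffP-neg : ∀ P i j → coeffP (-P P) i j ≡ ℤ.- coeffP P i j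
coeffP-neg P i j = ≡.trans (coeffP-sumOver (-P P) i j) (≡.trans (sumOver-map P negTerm _)
  (≡.trans (sumOver-cong P (λ t → termCoeff-negTerm t i j))
  (≡.trans (sumOver-neg P (λ t → termCoeff t i j)) (≡.cong ℤ.-_ (≡.sym (coeffP-sumOver P i j))))))

coeffP-*-termwise : ∀ P Q i j → coeffP (P *P Q) i j ≡ sumOver P (λ s → sumOver Q (λ t → termCoeff (mulTerm s t) i j))
coeffP-*-termwise P Q i j = ≡.trans (coeffP-sumOver (P *P Q) i j)
  (≡.trans (sumOver-concatMap P (λ s → map (mulTerm s) Q) _) (sumOver-cong P (λ s → sumOver-map Q (mulTerm s) _)))

coeffP-* : ∀ P Q i j →
  coeffP (P *P Q) i j ≡ sumOver P (λ s → proj₁ s ℤ.* coeffP Q (i ℤ.- proj₁ (proj₂ s)) (j ℤ.- proj₂ (proj₂ s)))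
coeffP-* P Q i j = ≡.trans (coeffP-*-termwise P Q i j) (sumOver-cong P λ s →
  ≡.trans (sumOver-cong Q (λ t → termCoeff-mulTerm s t i j))
  (≡.trans (≡.sym (sumOver-*ˡ Q (proj₁ s) _)) (≡.cong (λ z → proj₁ s ℤ.* z) (≡.sym (coeffP-sumOver Q _ _)))))

-- Coefficientwise equality, wrapped in a record so that Agda can infer the polynomials from it.
infix 4 _≋_
record _≋_ (P Q : Poly) : Set where
  constructor mk≋
  field coeffP-≡ : P ≈P Q
open _≋_ public

≋-isEquivalence : IsEquivalence _≋_
≋-isEquivalence = record
  { refl  = mk≋ (λ _ _ → ≡.refl)
  ; sym   = λ (mk≋ P≈Q) → mk≋ (λ i j → ≡.sym (P≈Q i j))
  ; trans = λ (mk≋ P≈Q) (mk≋ Q≈R) → mk≋ (λ i j → ≡.trans (P≈Q i j) (Q≈R i j))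
  }

private
  module ≋ = IsEquivalence ≋-isEquivalence

+P-cong : ∀ {P P′ Q Q′} → P ≋ P′ → Q ≋ Q′ → (P +P Q) ≋ (P′ +P Q′)
+P-cong {P} {P′} {Q} {Q′} (mk≋ P≈P′) (mk≋ Q≈Q′) = mk≋ λ i j →
  ≡.trans (coeffP-++ P Q i j) (≡.trans (≡.cong₂ ℤ._+_ (P≈P′ i j) (Q≈Q′ i j)) (≡.sym (coeffP-++ P′ Q′ i j)))

+P-assoc : ∀ P Q R → ((P +P Q) +P R) ≋ (P +P (Q +P R))
+P-assoc P Q R = mk≋ λ i j → ≡.cong (λ T → coeffP T i j) (Listₚ.++-assoc P Q R)

+P-comm : ∀ P Q → (P +P Q) ≋ (Q +P P)
+P-comm P Q = mk≋ λ i j →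
  ≡.trans (coeffP-++ P Q i j) (≡.trans (ℤₚ.+-comm (coeffP P i j) _) (≡.sym (coeffP-++ Q P i j)))

+P-identityˡ : ∀ P → ([] +P P) ≋ P
+P-identityˡ P = ≋.refl

-P-cong : ∀ {P Q} → P ≋ Q → (-P P) ≋ (-P Q)
-P-cong {P} {Q} (mk≋ P≈Q) = mk≋ λ i j →
  ≡.trans (coeffP-neg P i j) (≡.trans (≡.cong ℤ.-_ (P≈Q i j)) (≡.sym (coeffP-neg Q i j)))

-P-inverseˡ : ∀ P → ((-P P) +P P) ≋ []
-P-inverseˡ P = mk≋ λ i j → ≡.trans (coeffP-++ (-P P) P i j)
  (≡.trans (≡.cong (ℤ._+ coeffP P i j) (coeffP-neg P i j)) (ℤₚ.+-inverseˡ (coeffP P i j)))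

*P-comm : ∀ P Q → (P *P Q) ≋ (Q *P P)
*P-comm P Q = mk≋ λ i j → ≡.trans (coeffP-*-termwise P Q i j) (≡.trans (sumOver-comm P Q _)
  (≡.trans (sumOver-cong Q (λ t → sumOver-cong P (λ s → ≡.cong (λ x → termCoeff x i j) (mulTerm-comm s t))))
  (≡.sym (coeffP-*-termwise Q P i j))))
  where
  mulTerm-comm : ∀ s t → mulTerm s t ≡ mulTerm t s
  mulTerm-comm (c , u , v) (d , u′ , v′) rewrite ℤₚ.*-comm c d | ℤₚ.+-comm u u′ | ℤₚ.+-comm v v′ = ≡.refl

*P-congˡ : ∀ P {Q Q′} → Q ≋ Q′ → (P *P Q) ≋ (P *P Q′)
*P-congˡ P {Q} {Q′} (mk≋ Q≈Q′) = mk≋ λ i j → ≡.trans (coeffP-* P Q i j)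
  (≡.trans (sumOver-cong P (λ s → ≡.cong (λ z → proj₁ s ℤ.* z) (Q≈Q′ _ _))) (≡.sym (coeffP-* P Q′ i j)))

*P-cong : ∀ {P P′ Q Q′} → P ≋ P′ → Q ≋ Q′ → (P *P Q) ≋ (P′ *P Q′)
*P-cong {P} {P′} {Q} {Q′} P≋P′ Q≋Q′ =
  ≋.trans (*P-congˡ P Q≋Q′) (≋.trans (*P-comm P Q′) (≋.trans (*P-congˡ Q′ P≋P′) (*P-comm Q′ P′)))

*P-assoc : ∀ P Q R → ((P *P Q) *P R) ≋ (P *P (Q *P R))
*P-assoc P Q R = mk≋ λ i j →
  ≡.trans (coeffP-*-termwise (P *P Q) R i j)
  (≡.trans (sumOver-concatMap P (λ s → map (mulTerm s) Q) _)
  (≡.trans (sumOver-cong P (λ s → ≡.trans (sumOver-map Q (mulTerm s) _) (sumOver-cong Q (λ t →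
       ≡.trans (sumOver-cong R (λ u → ≡.cong (λ x → termCoeff x i j) (mulTerm-assoc s t u))) (≡.sym (sumOver-map R (mulTerm t) _))))))
  (≡.trans (sumOver-cong P (λ s → ≡.sym (sumOver-concatMap Q (λ t → map (mulTerm t) R) _)))
  (≡.sym (coeffP-*-termwise P (Q *P R) i j)))))
  where
  mulTerm-assoc : ∀ s t u → mulTerm (mulTerm s t) u ≡ mulTerm s (mulTerm t u)
  mulTerm-assoc (c , u , v) (d , u′ , v′) (e , u″ , v″)
    rewrite ℤₚ.*-assoc c d e | ℤₚ.+-assoc u u′ u″ | ℤₚ.+-assoc v v′ v″ = ≡.refl

*P-identityˡ : ∀ P → (oneP *P P) ≋ P
*P-identityˡ P = mk≋ λ i j → ≡.trans (coeffP-*-termwise oneP P i j) (≡.trans (ℤₚ.+-identityʳ _)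
  (≡.trans (sumOver-cong P (λ t → ≡.cong (λ x → termCoeff x i j) (mulTerm-identityˡ t))) (≡.sym (coeffP-sumOver P i j))))
  where
  mulTerm-identityˡ : ∀ t → mulTerm (+ 1 , + 0 , + 0) t ≡ t
  mulTerm-identityˡ (d , u , v) rewrite ℤₚ.*-identityˡ d | ℤₚ.+-identityˡ u | ℤₚ.+-identityˡ v = ≡.refl

*P-distribʳ : ∀ R P Q → ((P +P Q) *P R) ≋ ((P *P R) +P (Q *P R))
*P-distribʳ R P Q = mk≋ λ i j → ≡.trans (coeffP-*-termwise (P +P Q) R i j) (≡.trans (sumOver-++ P Q _)
  (≡.trans (≡.sym (≡.cong₂ ℤ._+_ (coeffP-*-termwise P R i j) (coeffP-*-termwise Q R i j))) (≡.sym (coeffP-++ (P *P R) (Q *P R) i j))))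

laurentRing : CommutativeRing 0ℓ 0ℓ
laurentRing = record
  { isCommutativeRing = isCommutativeRing-fromLeftLaws {_+_ = _+P_} {_*_ = _*P_} { -_ = -P_} {0# = []} {1# = oneP} ≋-isEquivalence
      +P-cong *P-cong -P-cong +P-assoc +P-comm +P-identityˡ -P-inverseˡ *P-assoc *P-comm *P-identityˡ *P-distribʳ
  }

private
  module L = CommutativeRing laurentRing

-- Fractions with non-zero-divisor denominators

Cancellable : Poly → Set
Cancellable d = ∀ Q → (d *P Q) ≋ [] → Q ≋ []

oneP-cancellable : Cancellable oneP
oneP-cancellable Q 1Q≋0 = ≋.trans (≋.sym (*P-identityˡ Q)) 1Q≋0

*P-cancellable : ∀ {d e} → Cancellable d → Cancellable e → Cancellable (d *P e)
*P-cancellable {d} {e} d-canc e-canc Q deQ≋0 = e-canc Q (d-canc (e *P Q) (≋.trans (≋.sym (*P-assoc d e Q)) deQ≋0))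

*P-cancelˡ : ∀ {d} → Cancellable d → ∀ P Q → (d *P P) ≋ (d *P Q) → P ≋ Q
*P-cancelˡ {d} d-canc P Q dP≋dQ = x∙y⁻¹≈ε⇒x≈y P Q (d-canc (P +P (-P Q)) (begin
  d *P (P +P (-P Q))          ≈⟨ L.distribˡ d P (-P Q) ⟩
  (d *P P) +P (d *P (-P Q))   ≈⟨ L.+-congˡ (-‿distribʳ-* d Q) ⟨
  (d *P P) +P (-P (d *P Q))   ≈⟨ L.+-congʳ dP≋dQ ⟩
  (d *P Q) +P (-P (d *P Q))   ≈⟨ L.-‿inverseʳ (d *P Q) ⟩
  []                          ∎))
  where
  open import Algebra.Properties.Ring L.ring using (-‿distribʳ-*)
  open import Algebra.Properties.AbelianGroup L.+-abelianGroup using (x∙y⁻¹≈ε⇒x≈y)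
  open import Relation.Binary.Reasoning.Setoid L.setoid

-- Elements of K whose denominator is not a zero divisor; on these ≈K is transitive.
Fraction : Set
Fraction = Σ K (λ x → Cancellable (K.den x))

private
  num den : Fraction → Poly
  num x = K.num (proj₁ x)
  den x = K.den (proj₁ x)

infix 4 _≃_
record _≃_ (x y : Fraction) : Set where
  constructor mk≃
  field cross-≋ : (num x *P den y) ≋ (num y *P den x)
open _≃_ public

private
  module KR = RawRing K-rawRing

_+F_ _*F_ : Fraction → Fraction → Fraction
(x , x-canc) +F (y , y-canc) = x KR.+ y , *P-cancellable {K.den x} {K.den y} x-canc y-canc
(x , x-canc) *F (y , y-canc) = x KR.* y , *P-cancellable {K.den x} {K.den y} x-canc y-canc

-F_ : Fraction → Fraction
-F (x , x-canc) = KR.- x , x-canc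

0F 1F : Fraction
0F = KR.0# , oneP-cancellable
1F = KR.1# , oneP-cancellable

module _ where
  open L using (_+_; _*_; -_)
  open import Algebra.Properties.Ring L.ring using (-‿distribˡ-*)
  open import Algebra.Solver.Ring.NaturalCoefficients.Default L.commutativeSemiring using (solve; _:=_; _:+_; _:*_)
  open import Relation.Binary.Reasoning.Setoid L.setoid

  ≃-isEquivalence : IsEquivalence _≃_
  ≃-isEquivalence = record
    { refl  = mk≃ L.refl
    ; sym   = λ (mk≃ x≃y) → mk≃ (L.sym x≃y)
    ; trans = λ {x} {y} {z} → ≃-trans {x} {y} {z}
    }
    where
    ≃-trans : ∀ {x y z} → x ≃ y → y ≃ z → x ≃ z
    ≃-trans {x} {y} {z} (mk≃ x≃y) (mk≃ y≃z) = mk≃ (*P-cancelˡ {den y} (proj₂ y) (num x * den z) (num z * den x) (begin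
      den y * (num x * den z)   ≈⟨ regroup₁ (den y) (num x) (den z) ⟩
      (num x * den y) * den z   ≈⟨ L.*-congʳ x≃y ⟩
      (num y * den x) * den z   ≈⟨ regroup₂ (num y) (den x) (den z) ⟩
      (num y * den z) * den x   ≈⟨ L.*-congʳ y≃z ⟩
      (num z * den y) * den x   ≈⟨ regroup₁ (den y) (num z) (den x) ⟨
      den y * (num z * den x)   ∎))
      where
      regroup₁ : ∀ a b c → a * (b * c) ≋ (b * a) * c
      regroup₁ = solve 3 (λ a b c → a :* (b :* c) := (b :* a) :* c) L.refl
      regroup₂ : ∀ a b c → (a * b) * c ≋ (a * c) * b
      regroup₂ = solve 3 (λ a b c → (a :* b) :* c := (a :* c) :* b) L.refl

  +F-cong : ∀ {x x′ y y′} → x ≃ x′ → y ≃ y′ → (x +F y) ≃ (x′ +F y′)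
  +F-cong {x} {x′} {y} {y′} (mk≃ x≃x′) (mk≃ y≃y′) = mk≃ (begin
    (num x * den y + num y * den x) * (den x′ * den y′)
      ≈⟨ regroup₁ (num x) (den y) (num y) (den x) (den x′) (den y′) ⟩
    (num x * den x′) * (den y * den y′) + (num y * den y′) * (den x * den x′)
      ≈⟨ L.+-cong (L.*-congʳ x≃x′) (L.*-congʳ y≃y′) ⟩
    (num x′ * den x) * (den y * den y′) + (num y′ * den y) * (den x * den x′)
      ≈⟨ regroup₂ (num x′) (den x) (den y) (den y′) (num y′) (den x′) ⟩
    (num x′ * den y′ + num y′ * den x′) * (den x * den y) ∎)
    where
    regroup₁ : ∀ a b c d e f → (a * b + c * d) * (e * f) ≋ (a * e) * (b * f) + (c * f) * (d * e)
    regroup₁ = solve 6 (λ a b c d e f → (a :* b :+ c :* d) :* (e :* f) := (a :* e) :* (b :* f) :+ (c :* f) :* (d :* e)) L.refl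
    regroup₂ : ∀ a b c d e f → (a * b) * (c * d) + (e * c) * (b * f) ≋ (a * d + e * f) * (b * c)
    regroup₂ = solve 6 (λ a b c d e f → (a :* b) :* (c :* d) :+ (e :* c) :* (b :* f) := (a :* d :+ e :* f) :* (b :* c)) L.refl

  *F-cong : ∀ {x x′ y y′} → x ≃ x′ → y ≃ y′ → (x *F y) ≃ (x′ *F y′)
  *F-cong {x} {x′} {y} {y′} (mk≃ x≃x′) (mk≃ y≃y′) = mk≃ (begin
    (num x * num y) * (den x′ * den y′)    ≈⟨ medial (num x) (num y) (den x′) (den y′) ⟩
    (num x * den x′) * (num y * den y′)    ≈⟨ L.*-cong x≃x′ y≃y′ ⟩
    (num x′ * den x) * (num y′ * den y)    ≈⟨ medial (num x′) (den x) (num y′) (den y) ⟩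
    (num x′ * num y′) * (den x * den y)    ∎)
    where
    medial : ∀ a b c d → (a * b) * (c * d) ≋ (a * c) * (b * d)
    medial = solve 4 (λ a b c d → (a :* b) :* (c :* d) := (a :* c) :* (b :* d)) L.refl

  -F-cong : ∀ {x x′} → x ≃ x′ → (-F x) ≃ (-F x′)
  -F-cong {x} {x′} (mk≃ x≃x′) = mk≃ (begin
    (- num x) * den x′     ≈⟨ -‿distribˡ-* (num x) (den x′) ⟨
    - (num x * den x′)     ≈⟨ L.-‿cong x≃x′ ⟩
    - (num x′ * den x)     ≈⟨ -‿distribˡ-* (num x′) (den x) ⟩
    (- num x′) * den x     ∎)

  +F-assoc : ∀ x y z → ((x +F y) +F z) ≃ (x +F (y +F z))
  +F-assoc x y z = mk≃ (law (num x) (den x) (num y) (den y) (num z) (den z))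
    where
    law : ∀ a b c d e f → ((a * d + c * b) * f + e * (b * d)) * (b * (d * f)) ≋ (a * (d * f) + (c * f + e * d) * b) * ((b * d) * f)
    law = solve 6 (λ a b c d e f → ((a :* d :+ c :* b) :* f :+ e :* (b :* d)) :* (b :* (d :* f))
                                := (a :* (d :* f) :+ (c :* f :+ e :* d) :* b) :* ((b :* d) :* f)) L.refl

  +F-comm : ∀ x y → (x +F y) ≃ (y +F x)
  +F-comm x y = mk≃ (law (num x) (den x) (num y) (den y))
    where
    law : ∀ a b c d → (a * d + c * b) * (d * b) ≋ (c * b + a * d) * (b * d)
    law = solve 4 (λ a b c d → (a :* d :+ c :* b) :* (d :* b) := (c :* b :+ a :* d) :* (b :* d)) L.refl

  +F-identityˡ : ∀ x → (0F +F x) ≃ x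
  +F-identityˡ x = mk≃ (law (num x) (den x) oneP)
    where
    law : ∀ a b o → (a * o) * b ≋ a * (o * b)
    law = solve 3 (λ a b o → (a :* o) :* b := a :* (o :* b)) L.refl

  -F-inverseˡ : ∀ x → ((-F x) +F x) ≃ 0F
  -F-inverseˡ x = mk≃ (begin
    ((- num x) * den x + num x * den x) * oneP   ≈⟨ L.*-identityʳ _ ⟩
    (- num x) * den x + num x * den x            ≈⟨ L.+-congʳ (-‿distribˡ-* (num x) (den x)) ⟨
    - (num x * den x) + num x * den x            ≈⟨ L.-‿inverseˡ (num x * den x) ⟩
    []                                           ∎)

  *F-assoc : ∀ x y z → ((x *F y) *F z) ≃ (x *F (y *F z))
  *F-assoc x y z = mk≃ (law (num x) (den x) (num y) (den y) (num z) (den z))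
    where
    law : ∀ a b c d e f → ((a * c) * e) * (b * (d * f)) ≋ (a * (c * e)) * ((b * d) * f)
    law = solve 6 (λ a b c d e f → ((a :* c) :* e) :* (b :* (d :* f)) := (a :* (c :* e)) :* ((b :* d) :* f)) L.refl

  *F-comm : ∀ x y → (x *F y) ≃ (y *F x)
  *F-comm x y = mk≃ (law (num x) (den x) (num y) (den y))
    where
    law : ∀ a b c d → (a * c) * (d * b) ≋ (c * a) * (b * d)
    law = solve 4 (λ a b c d → (a :* c) :* (d :* b) := (c :* a) :* (b :* d)) L.refl

  *F-identityˡ : ∀ x → (1F *F x) ≃ x
  *F-identityˡ x = mk≃ (law (num x) (den x) oneP)
    where
    law : ∀ a b o → (o * a) * b ≋ a * (o * b)
    law = solve 3 (λ a b o → (o :* a) :* b := a :* (o :* b)) L.refl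

  *F-distribʳ : ∀ x y z → ((y +F z) *F x) ≃ ((y *F x) +F (z *F x))
  *F-distribʳ x y z = mk≃ (law (num x) (den x) (num y) (den y) (num z) (den z))
    where
    law : ∀ a b c d e f → ((c * f + e * d) * a) * ((d * b) * (f * b)) ≋ ((c * a) * (f * b) + (e * a) * (d * b)) * ((d * f) * b)
    law = solve 6 (λ a b c d e f → ((c :* f :+ e :* d) :* a) :* ((d :* b) :* (f :* b))
                                := ((c :* a) :* (f :* b) :+ (e :* a) :* (d :* b)) :* ((d :* f) :* b)) L.refl

fractionRing : CommutativeRing 0ℓ 0ℓ
fractionRing = record
  { isCommutativeRing = isCommutativeRing-fromLeftLaws {_+_ = _+F_} {_*_ = _*F_} { -_ = -F_} {0# = 0F} {1# = 1F}
      ≃-isEquivalence (λ {x} {x′} {y} {y′} → +F-cong {x} {x′} {y} {y′}) (λ {x} {x′} {y} {y′} → *F-cong {x} {x′} {y} {y′})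
      (λ {x} {x′} → -F-cong {x} {x′}) +F-assoc +F-comm +F-identityˡ -F-inverseˡ *F-assoc *F-comm *F-identityˡ *F-distribʳ
  }

maxExpB : Poly → ℤ
maxExpB []                = + 0
maxExpB ((_ , _ , v) ∷ P) = v ℤ.⊔ maxExpB P

coeffP-above-maxExpB : ∀ P i j → maxExpB P ℤ.< j → coeffP P i j ≡ + 0
coeffP-above-maxExpB []                i j _ = ≡.refl
coeffP-above-maxExpB ((c , u , v) ∷ P) i j P<j with v ℤₚ.≟ j
... | yes ≡.refl = ⊥-elim (ℤₚ.<-irrefl ≡.refl (ℤₚ.≤-<-trans (ℤₚ.i≤i⊔j v (maxExpB P)) P<j))
... | no _ rewrite Boolₚ.∧-zeroʳ (does (u ℤₚ.≟ i)) =
  ≡.trans (ℤₚ.+-identityˡ _) (coeffP-above-maxExpB P i j (ℤₚ.≤-<-trans (ℤₚ.i≤j⊔i v (maxExpB P)) P<j))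

-- Iterating the shift pushes any point above the bound B.
shift-invariant⇒zero : ∀ (f : ℤ → ℤ → ℤ) B α k → (∀ x y → B ℤ.< y → f x y ≡ + 0) →
                       (∀ x y → f x y ≡ f (x ℤ.+ α) (y ℤ.+ + suc k)) → ∀ x y → f x y ≡ + 0
shift-invariant⇒zero f B α k f-bounded f-shift x y = go (suc ℤ.∣ B ℤ.- y ∣) x y B<y+∣B-y∣+1
  where
  go : ∀ n x y → B ℤ.< y ℤ.+ + n → f x y ≡ + 0
  go zero    x y B<y   = f-bounded x y (≡.subst (B ℤ.<_) (ℤₚ.+-identityʳ y) B<y)
  go (suc n) x y B<y+n = ≡.trans (f-shift x y) (go n (x ℤ.+ α) (y ℤ.+ + suc k) (ℤₚ.<-≤-trans B<y+n y+n≤y+k+n))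
    where
    y+n≤y+k+n : y ℤ.+ + suc n ℤ.≤ (y ℤ.+ + suc k) ℤ.+ + n
    y+n≤y+k+n = ℤₚ.≤-trans (ℤₚ.+-monoʳ-≤ y (ℤ.+≤+ (s≤s (ℕₚ.m≤n+m n k)))) (ℤₚ.≤-reflexive (≡.sym (ℤₚ.+-assoc y (+ suc k) (+ n))))
  i≤∣i∣ : ∀ i → i ℤ.≤ + ℤ.∣ i ∣
  i≤∣i∣ (+ _)    = ℤₚ.≤-refl
  i≤∣i∣ -[1+ _ ] = ℤ.-≤+
  B<y+∣B-y∣+1 : B ℤ.< y ℤ.+ + suc ℤ.∣ B ℤ.- y ∣
  B<y+∣B-y∣+1 = ℤₚ.≤-<-trans (ℤₚ.≤-trans (ℤₚ.≤-reflexive (split B y)) (ℤₚ.+-monoʳ-≤ y (i≤∣i∣ (B ℤ.- y))))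
                             (ℤₚ.+-monoʳ-< y (ℤ.+<+ (ℕₚ.n<1+n _)))
    where
    split : ∀ B y → B ≡ y ℤ.+ (B ℤ.- y)
    split = solve-∀

binomial : ℤ → ℤ → ℤ → ℤ → Poly
binomial u v u′ v′ = (+ 1 , u , v) ∷ (-[1+ 0 ] , u′ , v′) ∷ []

binomial-annihilates : ∀ u v u′ v′ Q → binomial u v u′ v′ *P Q ≋ [] →
                       ∀ i j → coeffP Q (i ℤ.- u) (j ℤ.- v) ≡ coeffP Q (i ℤ.- u′) (j ℤ.- v′)
binomial-annihilates u v u′ v′ Q (mk≋ dQ≋0) i j =
  ≡.trans (rearrange X Y) (≡.trans (≡.cong (ℤ._+ Y) (≡.trans (≡.sym (coeffP-* (binomial u v u′ v′) Q i j)) (dQ≋0 i j))) (ℤₚ.+-identityˡ Y))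
  where
  X Y : ℤ
  X = coeffP Q (i ℤ.- u) (j ℤ.- v)
  Y = coeffP Q (i ℤ.- u′) (j ℤ.- v′)
  rearrange : ∀ X Y → X ≡ (+ 1 ℤ.* X ℤ.+ (-[1+ 0 ] ℤ.* Y ℤ.+ + 0)) ℤ.+ Y
  rearrange = solve-∀

-- The gap v′ - v > 0 turns the relation into invariance under a shift that raises the exponent of b.
related-shift⇒zero : ∀ Q u v u′ v′ k → v′ ≡ v ℤ.+ + suc k →
  (∀ i j → coeffP Q (i ℤ.- u) (j ℤ.- v) ≡ coeffP Q (i ℤ.- u′) (j ℤ.- v′)) → Q ≋ []
related-shift⇒zero Q u v u′ v′ k v′≡v+k+1 related =
  mk≋ (shift-invariant⇒zero (coeffP Q) (maxExpB Q) (u′ ℤ.- u) k (coeffP-above-maxExpB Q) shift)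
  where
  shift : ∀ x y → coeffP Q x y ≡ coeffP Q (x ℤ.+ (u′ ℤ.- u)) (y ℤ.+ + suc k)
  shift x y = begin
    coeffP Q x y                                        ≡⟨ ≡.cong₂ (coeffP Q) (cancel x u′) (cancel y v′) ⟨
    coeffP Q ((x ℤ.+ u′) ℤ.- u′) ((y ℤ.+ v′) ℤ.- v′)    ≡⟨ related (x ℤ.+ u′) (y ℤ.+ v′) ⟨
    coeffP Q ((x ℤ.+ u′) ℤ.- u) ((y ℤ.+ v′) ℤ.- v)
      ≡⟨ ≡.cong₂ (coeffP Q) (regroup x u′ u) (≡.trans (≡.cong (λ w → (y ℤ.+ w) ℤ.- v) v′≡v+k+1) (shifted y v (+ suc k))) ⟩
    coeffP Q (x ℤ.+ (u′ ℤ.- u)) (y ℤ.+ + suc k)         ∎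
    where
    open ≡.≡-Reasoning
    cancel : ∀ a b → (a ℤ.+ b) ℤ.- b ≡ a
    cancel = solve-∀
    regroup : ∀ a b c → (a ℤ.+ b) ℤ.- c ≡ a ℤ.+ (b ℤ.- c)
    regroup = solve-∀
    shifted : ∀ a b c → (a ℤ.+ (b ℤ.+ c)) ℤ.- b ≡ a ℤ.+ c
    shifted = solve-∀

-- These are p - q = a² - b² and q - 1 = b² - 1, literally the denominators of pqNum i and qNum i.
[p-q]-cancellable : Cancellable (binomial (+ 2) (+ 0) (+ 0) (+ 2))
[p-q]-cancellable Q dQ≋0 =
  related-shift⇒zero Q (+ 2) (+ 0) (+ 0) (+ 2) 1 ≡.refl (binomial-annihilates (+ 2) (+ 0) (+ 0) (+ 2) Q dQ≋0)

[q-1]-cancellable : Cancellable (binomial (+ 0) (+ 2) (+ 0) (+ 0))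
[q-1]-cancellable Q dQ≋0 =
  related-shift⇒zero Q (+ 0) (+ 0) (+ 0) (+ 2) 1 ≡.refl (λ i j → ≡.sym (binomial-annihilates (+ 0) (+ 2) (+ 0) (+ 0) Q dQ≋0 i j))

-- The automorphism a, b ↦ a⁻¹, b⁻¹ and the roots

invTerm : Term → Term
invTerm (c , u , v) = (c , ℤ.- u , ℤ.- v)

does-≟-neg : ∀ u i → does (ℤ.- u ℤₚ.≟ i) ≡ does (u ℤₚ.≟ ℤ.- i)
does-≟-neg u i = does-≡-cong (λ eq → ≡.trans (≡.sym (ℤₚ.neg-involutive u)) (≡.cong ℤ.-_ eq))
                             (λ eq → ≡.trans (≡.cong ℤ.-_ eq) (ℤₚ.neg-involutive i))

termCoeff-invTerm : ∀ t i j → termCoeff (invTerm t) i j ≡ termCoeff t (ℤ.- i) (ℤ.- j)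
termCoeff-invTerm (c , u , v) i j rewrite does-≟-neg u i | does-≟-neg v j = ≡.refl

coeffP-invertP : ∀ P i j → coeffP (invertP P) i j ≡ coeffP P (ℤ.- i) (ℤ.- j)
coeffP-invertP P i j = ≡.trans (coeffP-sumOver (invertP P) i j) (≡.trans (sumOver-map P invTerm _)
  (≡.trans (sumOver-cong P (λ t → termCoeff-invTerm t i j)) (≡.sym (coeffP-sumOver P (ℤ.- i) (ℤ.- j)))))

invertP-cong : ∀ {P Q} → P ≋ Q → invertP P ≋ invertP Q
invertP-cong {P} {Q} (mk≋ P≈Q) = mk≋ λ i j →
  ≡.trans (coeffP-invertP P i j) (≡.trans (P≈Q _ _) (≡.sym (coeffP-invertP Q i j)))

invertP-involutive : ∀ P → invertP (invertP P) ≋ P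
invertP-involutive P = mk≋ λ i j → ≡.trans (coeffP-invertP (invertP P) i j)
  (≡.trans (coeffP-invertP P (ℤ.- i) (ℤ.- j)) (≡.cong₂ (coeffP P) (ℤₚ.neg-involutive i) (ℤₚ.neg-involutive j)))

invertP-+ : ∀ P Q → invertP (P +P Q) ≋ (invertP P +P invertP Q)
invertP-+ P Q = mk≋ λ i j → ≡.cong (λ R → coeffP R i j) (Listₚ.map-++ invTerm P Q)

invertP-neg : ∀ P → invertP (-P P) ≋ (-P invertP P)
invertP-neg P = mk≋ λ i j → ≡.trans (coeffP-invertP (-P P) i j) (≡.trans (coeffP-neg P _ _)
  (≡.trans (≡.cong ℤ.-_ (≡.sym (coeffP-invertP P i j))) (≡.sym (coeffP-neg (invertP P) i j))))

invertP-* : ∀ P Q → invertP (P *P Q) ≋ (invertP P *P invertP Q)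
invertP-* P Q = mk≋ λ i j →
  ≡.trans (coeffP-invertP (P *P Q) i j)
  (≡.trans (coeffP-*-termwise P Q (ℤ.- i) (ℤ.- j))
  (≡.trans (sumOver-cong P (λ s → sumOver-cong Q (λ t → mulTerm-invTerm s t i j)))
  (≡.trans (sumOver-cong P (λ s → ≡.sym (sumOver-map Q invTerm (λ t → termCoeff (mulTerm (invTerm s) t) i j))))
  (≡.trans (≡.sym (sumOver-map P invTerm (λ s → sumOver (invertP Q) (λ t → termCoeff (mulTerm s t) i j))))
  (≡.sym (coeffP-*-termwise (invertP P) (invertP Q) i j))))))
  where
  mulTerm-invTerm : ∀ s t i j → termCoeff (mulTerm s t) (ℤ.- i) (ℤ.- j) ≡ termCoeff (mulTerm (invTerm s) (invTerm t)) i j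
  mulTerm-invTerm (c , u , v) (d , u′ , v′) i j = ≡.trans (≡.sym (termCoeff-invTerm (c ℤ.* d , u ℤ.+ u′ , v ℤ.+ v′) i j))
    (≡.cong₂ (λ a b → termCoeff (c ℤ.* d , a , b) i j) (ℤₚ.neg-distrib-+ u u′) (ℤₚ.neg-distrib-+ v v′))

invertP-cancellable : ∀ {d} → Cancellable d → Cancellable (invertP d)
invertP-cancellable {d} d-canc Q dQ≋0 = ≋.trans (≋.sym (invertP-involutive Q)) (invertP-cong (d-canc (invertP Q) (begin
  d *P invertP Q                      ≈⟨ L.*-congʳ (invertP-involutive d) ⟨
  invertP (invertP d) *P invertP Q    ≈⟨ invertP-* (invertP d) Q ⟨
  invertP (invertP d *P Q)            ≈⟨ invertP-cong dQ≋0 ⟩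
  []                                  ∎)))
  where open import Relation.Binary.Reasoning.Setoid L.setoid

invF : Fraction → Fraction
invF (x , x-canc) = invK x , invertP-cancellable {K.den x} x-canc

private
  same-parts⇒≃ : ∀ x y → num x ≋ num y → den x ≋ den y → x ≃ y
  same-parts⇒≃ x y num≋ den≋ = mk≃ (L.*-cong num≋ (L.sym den≋))

invF-+ : ∀ x y → invF (x +F y) ≃ (invF x +F invF y)
invF-+ x y = same-parts⇒≃ (invF (x +F y)) (invF x +F invF y)
  (L.trans (invertP-+ (num x *P den y) (num y *P den x)) (L.+-cong (invertP-* (num x) (den y)) (invertP-* (num y) (den x))))
  (invertP-* (den x) (den y))

invF-* : ∀ x y → invF (x *F y) ≃ (invF x *F invF y)
invF-* x y = same-parts⇒≃ (invF (x *F y)) (invF x *F invF y) (invertP-* (num x) (num y)) (invertP-* (den x) (den y))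

invF-neg : ∀ x → invF (-F x) ≃ (-F invF x)
invF-neg x = same-parts⇒≃ (invF (-F x)) (-F invF x) (invertP-neg (num x)) L.refl

pqNumF qNumF : ℤ → Fraction
pqNumF i = pqNum i , [p-q]-cancellable
qNumF  i = qNum i , [q-1]-cancellable

private
  swap-pairs : ∀ {s₁ s₂ s₃ s₄ t₁ t₂ t₃ t₄ : Term} → s₁ ≡ t₂ → s₂ ≡ t₁ → s₃ ≡ t₄ → s₄ ≡ t₃ →
               (s₁ ∷ s₂ ∷ s₃ ∷ s₄ ∷ []) ≋ (t₁ ∷ t₂ ∷ t₃ ∷ t₄ ∷ [])
  swap-pairs {s₁} {s₂} {s₃} {s₄} ≡.refl ≡.refl ≡.refl ≡.refl = mk≋ λ i j →
    ≡.trans (coeffP-sumOver (s₁ ∷ s₂ ∷ s₃ ∷ s₄ ∷ []) i j)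
    (≡.trans (swap (termCoeff s₁ i j) (termCoeff s₂ i j) (termCoeff s₃ i j) (termCoeff s₄ i j))
    (≡.sym (coeffP-sumOver (s₂ ∷ s₁ ∷ s₄ ∷ s₃ ∷ []) i j)))
    where
    swap : ∀ a b c d → a ℤ.+ (b ℤ.+ (c ℤ.+ (d ℤ.+ + 0))) ≡ b ℤ.+ (a ℤ.+ (d ℤ.+ (c ℤ.+ + 0)))
    swap = solve-∀

  exponents : ∀ {c u u′ v v′ : ℤ} → u ≡ u′ → v ≡ v′ → (c , u , v) ≡ (c , u′ , v′)
  exponents ≡.refl ≡.refl = ≡.refl

  exponent₁ : ∀ i → ℤ.- (+ 1 ℤ.+ + 2 ℤ.* i) ℤ.+ + 2 ≡ (+ 1 ℤ.+ + 2 ℤ.* ℤ.- i) ℤ.+ + 0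
  exponent₁ = solve-∀

  exponent₂ : ∀ i → ℤ.- (+ 1 ℤ.+ + 2 ℤ.* i) ℤ.+ + 0 ≡ (+ 1 ℤ.+ + 2 ℤ.* ℤ.- i) ℤ.+ ℤ.- + 2
  exponent₂ = solve-∀

-- Both cross products consist of the same four monomials.
invF-pqNumF : ∀ i → invF (pqNumF i) ≃ -F pqNumF (ℤ.- i)
invF-pqNumF i = mk≃ (swap-pairs (exponents (exponent₁ i) ≡.refl) (exponents (exponent₂ i) ≡.refl)
                                (exponents ≡.refl (exponent₂ i)) (exponents ≡.refl (exponent₁ i)))

invF-qNumF : ∀ i → invF (qNumF i) ≃ -F qNumF (ℤ.- i)
invF-qNumF i = mk≃ (swap-pairs (exponents ≡.refl (exponent₁ i)) (exponents ≡.refl (exponent₂ i)) ≡.refl ≡.refl)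

private
  cancels : ∀ b → (if b then + 1 else + 0) ℤ.+ ((if b then -[1+ 0 ] else + 0) ℤ.+ + 0) ≡ + 0
  cancels true  = ≡.refl
  cancels false = ≡.refl

pqNumF-zero : pqNumF (+ 0) ≃ 0F
pqNumF-zero = mk≃ (mk≋ λ i j → cancels (does (+ 1 ℤₚ.≟ i) ∧ does (+ 1 ℤₚ.≟ j)))

qNumF-zero : qNumF (+ 0) ≃ 0F
qNumF-zero = mk≃ (mk≋ λ i j → cancels (does (+ 0 ℤₚ.≟ i) ∧ does (+ 1 ℤₚ.≟ j)))

-- Transfer to K

-- Stirling numbers are built from ring operations alone, so a relation respected by those operations relates them.
module Transport (R₁ R₂ : RawRing 0ℓ 0ℓ) (_∼_ : RawRing.Carrier R₁ → RawRing.Carrier R₂ → Set)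
  (0∼0 : RawRing.0# R₁ ∼ RawRing.0# R₂) (1∼1 : RawRing.1# R₁ ∼ RawRing.1# R₂)
  (+-pres : ∀ a b c d → a ∼ b → c ∼ d → RawRing._+_ R₁ a c ∼ RawRing._+_ R₂ b d)
  (*-pres : ∀ a b c d → a ∼ b → c ∼ d → RawRing._*_ R₁ a c ∼ RawRing._*_ R₂ b d)
  (neg-pres : ∀ a b → a ∼ b → RawRing.-_ R₁ a ∼ RawRing.-_ R₂ b)
  (r₁ : ℤ → RawRing.Carrier R₁) (r₂ : ℤ → RawRing.Carrier R₂) (r₁∼r₂ : ∀ i → r₁ i ∼ r₂ i) where

  module S₁ = Stirling R₁ r₁
  module S₂ = Stirling R₂ r₂

  sumTo-pres : ∀ n {f g} → (∀ t → f t ∼ g t) → S₁.sumTo n f ∼ S₂.sumTo n g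
  sumTo-pres zero    f∼g = 0∼0
  sumTo-pres (suc n) f∼g = +-pres _ _ _ _ (sumTo-pres n f∼g) (f∼g n)

  pow-pres : ∀ {c c′} → c ∼ c′ → ∀ n → S₁.pow c n ∼ S₂.pow c′ n
  pow-pres c∼c′ zero    = 1∼1
  pow-pres c∼c′ (suc n) = *-pres _ _ _ _ (pow-pres c∼c′ n) c∼c′

  _≈ˢ_ : S₁.Series → S₂.Series → Set
  f ≈ˢ g = (S₁.top f ≡ S₂.top g) × (∀ j → S₁.co f j ∼ S₂.co g j)

  ·-pres : ∀ {f f′ g g′} → f ≈ˢ f′ → g ≈ˢ g′ → (f S₁.· g) ≈ˢ (f′ S₂.· g′)
  ·-pres (top≡ , f∼f′) (top≡′ , g∼g′) = ≡.cong₂ ℤ._+_ top≡ top≡′ , λ j → sumTo-pres (suc j) (λ t → *-pres _ _ _ _ (f∼f′ t) (g∼g′ (j ℕ.∸ t)))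

  oneS-pres : S₁.oneS ≈ˢ S₂.oneS
  oneS-pres = ≡.refl , λ { zero → 1∼1 ; (suc _) → 0∼0 }

  xMinus-pres : ∀ {c c′} → c ∼ c′ → S₁.xMinus c ≈ˢ S₂.xMinus c′
  xMinus-pres c∼c′ = ≡.refl , λ { zero → 1∼1 ; (suc zero) → neg-pres _ _ c∼c′ ; (suc (suc _)) → 0∼0 }

  invXMinus-pres : ∀ {c c′} → c ∼ c′ → S₁.invXMinus c ≈ˢ S₂.invXMinus c′
  invXMinus-pres c∼c′ = ≡.refl , pow-pres c∼c′

  fall-pres : ∀ n → S₁.fall n ≈ˢ S₂.fall n
  fall-pres (+ zero)       = oneS-pres
  fall-pres (+ suc n)      = ·-pres (fall-pres (+ n)) (xMinus-pres (r₁∼r₂ (+ n)))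
  fall-pres -[1+ zero ]    = invXMinus-pres (r₁∼r₂ -[1+ 0 ])
  fall-pres -[1+ suc n ]   = ·-pres (fall-pres -[1+ n ]) (invXMinus-pres (r₁∼r₂ -[1+ suc n ]))

  coeff-pres : ∀ {f g} → f ≈ˢ g → ∀ m → S₁.coeff f m ∼ S₂.coeff g m
  coeff-pres {f} {g} (top≡ , f∼g) m with S₁.top f ℤ.- m | S₂.top g ℤ.- m | ≡.cong (ℤ._- m) top≡
  ... | + j      | _ | ≡.refl = f∼g j
  ... | -[1+ _ ] | _ | ≡.refl = 0∼0

  s-pres : ∀ n k → S₁.s n k ∼ S₂.s n k
  s-pres n k = coeff-pres (fall-pres n) k

  STab-pres : ∀ n d e → S₁.STab n d e ∼ S₂.STab n d e
  STab-pres n zero    e = 1∼1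
  STab-pres n (suc d) e with e ℕ.≡ᵇ suc d
  ... | true  = neg-pres _ _ (sumTo-pres (suc d) (λ t → *-pres _ _ _ _ (STab-pres n d t) (s-pres (n ℤ.- + t) (n ℤ.- + suc d))))
  ... | false = STab-pres n d e

  S-pres : ∀ n k → S₁.S n k ∼ S₂.S n k
  S-pres n k with n ℤ.- k
  ... | + d      = STab-pres n d d
  ... | -[1+ _ ] = 0∼0

  sign-pres : ∀ m → S₁.sign m ∼ S₂.sign m
  sign-pres m = signℕ-pres ℤ.∣ m ∣
    where
    signℕ-pres : ∀ m → S₁.signℕ m ∼ S₂.signℕ m
    signℕ-pres zero    = 1∼1
    signℕ-pres (suc m) = neg-pres _ _ (signℕ-pres m)

sign-independent : ∀ r r′ m → Stirling.sign K-rawRing r m ≡ Stirling.sign K-rawRing r′ m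
sign-independent r r′ m = signℕ-independent ℤ.∣ m ∣
  where
  signℕ-independent : ∀ m → Stirling.signℕ K-rawRing r m ≡ Stirling.signℕ K-rawRing r′ m
  signℕ-independent zero    = ≡.refl
  signℕ-independent (suc m) = ≡.cong KR.-_ (signℕ-independent m)

module FractionDuality (r : ℤ → Fraction) (invF-r : ∀ i → invF (r i) ≃ -F r (ℤ.- i)) (r0≃0 : r (+ 0) ≃ 0F) where
  private
    module F = CommutativeRing fractionRing

    rK : ℤ → K
    rK i = proj₁ (r i)

    invF∘r : ℤ → Fraction
    invF∘r i = invF (r i)

    _projects-to_ : Fraction → K → Set
    x projects-to y = proj₁ x ≡ y

    _inverts-to_ : Fraction → Fraction → Set
    x inverts-to y = invF x ≃ y

    r-projects : ∀ i → r i projects-to rK i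
    r-projects i = ≡.refl

    +-projects : ∀ a b c d → a projects-to b → c projects-to d → (a +F c) projects-to (b KR.+ d)
    +-projects _ _ _ _ = ≡.cong₂ KR._+_

    *-projects : ∀ a b c d → a projects-to b → c projects-to d → (a *F c) projects-to (b KR.* d)
    *-projects _ _ _ _ = ≡.cong₂ KR._*_

    neg-projects : ∀ a b → a projects-to b → (-F a) projects-to (KR.- b)
    neg-projects _ _ = ≡.cong KR.-_

    +-inverts : ∀ a b c d → a inverts-to b → c inverts-to d → (a +F c) inverts-to (b +F d)
    +-inverts a b c d a∼b c∼d = F.trans {invF (a +F c)} (invF-+ a c) (F.+-cong {invF a} {b} {invF c} {d} a∼b c∼d)

    *-inverts : ∀ a b c d → a inverts-to b → c inverts-to d → (a *F c) inverts-to (b *F d)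
    *-inverts a b c d a∼b c∼d = F.trans {invF (a *F c)} (invF-* a c) (F.*-cong {invF a} {b} {invF c} {d} a∼b c∼d)

    neg-inverts : ∀ a b → a inverts-to b → (-F a) inverts-to (-F b)
    neg-inverts a b a∼b = F.trans {invF (-F a)} (invF-neg a) (F.-‿cong {invF a} {b} a∼b)

    r-inverts : ∀ i → r i inverts-to invF∘r i
    r-inverts i = F.refl {invF (r i)}

    module SF = Stirling F.rawRing r
    module SK = Stirling K-rawRing rK
    module D = StirlingDuality.Duality fractionRing r invF∘r invF-r r0≃0

    module ToK = Transport F.rawRing K-rawRing _projects-to_ ≡.refl ≡.refl
      +-projects *-projects neg-projects r rK r-projects

    module Inv = Transport F.rawRing F.rawRing _inverts-to_ (mk≃ L.refl) (mk≃ L.refl)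
      +-inverts *-inverts neg-inverts r invF∘r r-inverts

  S≈signK*invK-s : ∀ n k → SK.S n k ≈K (signK (n ℤ.+ k) *K invK (SK.s (ℤ.- k) (ℤ.- n)))
  S≈signK*invK-s n k = ≡.subst₂ _≈K_ (ToK.S-pres n k)
    (≡.cong₂ _*K_ (≡.trans (ToK.sign-pres (n ℤ.+ k)) (sign-independent rK pqNum (n ℤ.+ k))) (≡.cong invK (ToK.s-pres (ℤ.- k) (ℤ.- n))))
    (coeffP-≡ (cross-≋ in-fractions))
    where
    σ : Fraction
    σ = SF.sign (n ℤ.+ k)
    in-fractions : SF.S n k ≃ (σ *F invF (SF.s (ℤ.- k) (ℤ.- n)))
    in-fractions = F.trans {SF.S n k} {σ *F Inv.S₂.s (ℤ.- k) (ℤ.- n)} (D.S≈Ŝ n k)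
      (F.*-congˡ {σ} (F.sym {invF (SF.s (ℤ.- k) (ℤ.- n))} (Inv.s-pres (ℤ.- k) (ℤ.- n))))

open import Data.Integer using (-_; _+_; _*_)

mainTheorem15 :
      (∀ (n k : ℤ) → S-pq n k ≈K (signK (n + k) *K s-pq⁻¹ (- k) (- n)))
    × (∀ (n k : ℤ) → S-q n k ≈K (signK (n + k) *K s-q⁻¹ (- k) (- n)))
    × (∀ (n k : ℤ) → S-cl n k ≡ signℤ (n + k) * s-cl (- k) (- n))
mainTheorem15 =
    FractionDuality.S≈signK*invK-s pqNumF invF-pqNumF pqNumF-zero
  , FractionDuality.S≈signK*invK-s qNumF invF-qNumF qNumF-zero
  , StirlingDuality.Duality.S≈Ŝ ℤₚ.+-*-commutativeRing id id (λ i → ≡.sym (ℤₚ.neg-involutive i)) ≡.refl
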